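{- Let $M=(S,T,I,L)$ be a Kripke structure and $\psi$ an LTL formula in positive normal form. Then $M$ has an initialised infinite path $\pi$ such that $\pi\models\psi$ if and only if there exists $k\in\mathbb{N}$ such that the fixpoint evaluation encoding $[\![M,\psi,k]\!]$ is satisfiable. In particular, if $\pi$ is an initialised infinite path of $M$ with $\pi\models_k\psi$, then $[\![M,\psi,k]\!]$ is satisfiable.
   Context: Kripke structures: $AP$ is a set of atomic propositions; $M=(S,T,I,L)$ has a finite set of states $S$ (symbolically: valuations of finitely many Boolean state variables), a total transition relation $T\subseteq S\times S$, initial states $I\subseteq S$ and labelling $L:S\to 2^{AP}$. An infinite path $\pi=s_0s_1\ldots$ (with $(s_i,s_{i+1})\in T$) is initialised if $s_0\in I$; $\pi^i$ denotes $\pi$ with evaluation position $i$. LTL formulas in positive normal form are built from $p,\neg p$ ($p\in AP$) with $\wedge,\vee,\mathbf{X},\mathbf{U},\mathbf{R}$, with semantics: $\pi^i\models p$ iff $p\in L(s_i)$; $\pi^i\models\neg p$ iff not; $\wedge,\vee$ as usual; $\pi^i\models\mathbf{X}\psi_1$ iff $\pi^{i+1}\models\psi_1$; $\pi^i\models\psi_1\mathbf{U}\psi_2$ iff $\exists j\ge i$ with $\pi^j\models\psi_2$ and $\pi^n\models\psi_1$ for all $i\le n<j$; $\pi^i\models\psi_1\mathbf{R}\psi_2$ iff for all $j\ge i$, $\pi^j\models\psi_2$ or $\pi^n\models\psi_1$ for some $i\le n<j$. $\pi\models\psi$ means $\pi^0\models\psi$. $(k,l)$-loops and bounded semantics: $\pi$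 is a $(k,l)$-loop if $\pi=(s_0\ldots s_{l-1})(s_l\ldots s_k)^\omega$ with $0<l\le k$ and $s_{l-1}=s_k$. $\pi\models_k\psi$ iff (a) $\pi$ is a $(k,l)$-loop for some $0<l\le k$ and $\pi^0\models\psi$, or (b) $\pi^0\models^{nl}_k\psi$, where $\models^{nl}_k$ agrees with $\models$ on $p,\neg p,\wedge,\vee$ and: $\pi^i\models^{nl}_k\mathbf{X}\psi_1$ iff $i<k$ and $\pi^{i+1}\models^{nl}_k\psi_1$; $\pi^i\models^{nl}_k\psi_1\mathbf{U}\psi_2$ iff $\exists i\le j\le k$ with $\pi^j\models^{nl}_k\psi_2$ and $\pi^n\models^{nl}_k\psi_1$ for all $i\le n<j$; $\pi^i\models^{nl}_k\psi_1\mathbf{R}\psi_2$ iff $\exists i\le j\le k$ with $\pi^j\models^{nl}_k\psi_1$ and $\pi^n\models^{nl}_k\psi_2$ for all $i\le n\le j$. Encoding. For bound $k$ take propositional copies $s_0,\dots,s_k$ of the state variables. Model constraints: $[\![M]\!]_k=I(s_0)\wedge\bigwedge_{i=1}^k T(s_{i-1},s_i)$. Loop constraints (fresh variables $l_0,\dots,l_k$, $\mathit{InLoop}_0,\dots,\mathit{InLoop}_k$, $\mathit{LoopExists}$): $l_0\Leftrightarrow\bot$, $\mathit{InLoop}_0\Leftrightarrow\bot$, and for $1\le i\le k$: $l_i\Rightarrow(s_{i-1}=s_k)$, $\mathit{InLoop}_i\Leftrightarrow\mathit{InLoop}_{i-1}\vee l_i$, $\mathit{InLoop}_{i-1}\Rightarrow\neg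 l_i$; and $\mathit{LoopExists}\Leftrightarrow\mathit{InLoop}_k$. Formula translation $[\![\varphi]\!]_i$ ($0\le i\le k$), defined recursively: $[\![p]\!]_i$ is the propositional formula over $s_i$ expressing $p\in L(s_i)$, $[\![\neg p]\!]_i$ its negation, $[\![\psi_1\wedge\psi_2]\!]_i=[\![\psi_1]\!]_i\wedge[\![\psi_2]\!]_i$, $[\![\psi_1\vee\psi_2]\!]_i=[\![\psi_1]\!]_i\vee[\![\psi_2]\!]_i$. For $0\le i<k$: $[\![\mathbf{X}\psi_1]\!]_i=[\![\psi_1]\!]_{i+1}$, $[\![\psi_1\mathbf{U}\psi_2]\!]_i=[\![\psi_2]\!]_i\vee([\![\psi_1]\!]_i\wedge[\![\psi_1\mathbf{U}\psi_2]\!]_{i+1})$, $[\![\psi_1\mathbf{R}\psi_2]\!]_i=[\![\psi_2]\!]_i\wedge([\![\psi_1]\!]_i\vee[\![\psi_1\mathbf{R}\psi_2]\!]_{i+1})$. For $i=k$: $[\![\mathbf{X}\psi_1]\!]_k=\bigvee_{j=1}^k(l_j\wedge[\![\psi_1]\!]_j)$, $[\![\psi_1\mathbf{U}\psi_2]\!]_k=[\![\psi_2]\!]_k\vee([\![\psi_1]\!]_k\wedge\bigvee_{j=1}^k(l_j\wedge\langle\!\langle\psi_1\mathbf{U}\psi_2\rangle\!\rangle_j))$, $[\![\psi_1\mathbf{R}\psi_2]\!]_k=[\![\psi_2]\!]_k\wedge([\![\psi_1]\!]_k\vee\bigvee_{j=1}^k(l_j\wedge\langle\!\langle\psi_1\mathbf{R}\psi_2\rangle\!\rangle_j))$.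 Auxiliary translation for $1\le i<k$: $\langle\!\langle\psi_1\mathbf{U}\psi_2\rangle\!\rangle_i=[\![\psi_2]\!]_i\vee([\![\psi_1]\!]_i\wedge\langle\!\langle\psi_1\mathbf{U}\psi_2\rangle\!\rangle_{i+1})$, $\langle\!\langle\psi_1\mathbf{R}\psi_2\rangle\!\rangle_i=[\![\psi_2]\!]_i\wedge([\![\psi_1]\!]_i\vee\langle\!\langle\psi_1\mathbf{R}\psi_2\rangle\!\rangle_{i+1})$, and $\langle\!\langle\psi_1\mathbf{U}\psi_2\rangle\!\rangle_k=\langle\!\langle\psi_1\mathbf{R}\psi_2\rangle\!\rangle_k=[\![\psi_2]\!]_k$. The fixpoint evaluation encoding is $[\![M,\psi,k]\!]=[\![M]\!]_k\wedge(\text{loop constraints})\wedge[\![\psi]\!]_0$. -}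

module Defs where

open import Data.Nat using (ℕ; zero; suc; _≤_; _<_; _∸_; _+_; _<ᵇ_)
open import Data.Bool using (Bool; true; false; not; _∧_; _∨_; _xor_; if_then_else_)
open import Data.Vec using (Vec)
open import Data.Vec.Properties using (≡-dec)
import Data.Bool as B
open import Data.Product using (Σ; ∃; _×_)
open import Data.Sum using (_⊎_)
open import Relation.Binary.PropositionalEquality using (_≡_)
open import Relation.Nullary.Decidable using (⌊_⌋)

-- The initial-state predicate, the transition
-- relation and the labelling are given as Boolean functions of the
-- state variables (i.e. as propositional formulas over them, up to
-- semantic equivalence).

record Kripke (AP : Set) : Set where
  field
    n     : ℕ
    T     : Vec Bool n → Vec Bool n → Bool
    total : ∀ s → ∃ λ s' → T s s' ≡ true
    I     : Vec Bool n → Bool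
    L     : Vec Bool n → AP → Bool

  State : Set
  State = Vec Bool n

data LTL (AP : Set) : Set where
  atom  : AP → LTL AP
  natom : AP → LTL AP
  _∧ₗ_  : LTL AP → LTL AP → LTL AP
  _∨ₗ_  : LTL AP → LTL AP → LTL AP
  Xₗ    : LTL AP → LTL AP
  _Uₗ_  : LTL AP → LTL AP → LTL AP
  _Rₗ_  : LTL AP → LTL AP → LTL AP

module _ {AP : Set} (M : Kripke AP) where
  open Kripke M

  IsPath : (ℕ → State) → Set
  IsPath π = ∀ i → T (π i) (π (suc i)) ≡ true

  Initialised : (ℕ → State) → Set
  Initialised π = I (π 0) ≡ true

  _,_⊨_ : (ℕ → State) → ℕ → LTL AP → Set
  π , i ⊨ atom p    = L (π i) p ≡ true
  π , i ⊨ natom p   = L (π i) p ≡ false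
  π , i ⊨ (φ ∧ₗ ψ)  = (π , i ⊨ φ) × (π , i ⊨ ψ)
  π , i ⊨ (φ ∨ₗ ψ)  = (π , i ⊨ φ) ⊎ (π , i ⊨ ψ)
  π , i ⊨ Xₗ φ      = π , suc i ⊨ φ
  π , i ⊨ (φ Uₗ ψ)  = ∃ λ j → i ≤ j × (π , j ⊨ ψ)
                        × (∀ m → i ≤ m → m < j → π , m ⊨ φ)
  π , i ⊨ (φ Rₗ ψ)  = ∀ j → i ≤ j →
                        (π , j ⊨ ψ) ⊎ (∃ λ m → i ≤ m × m < j × (π , m ⊨ φ))

  -- π is a (k,l)-loop: π = (s_0 … s_{l-1})(s_l … s_k)^ω, 0 < l ≤ k, s_{l-1} = s_k
  IsLoop : ℕ → ℕ → (ℕ → State) → Set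
  IsLoop k l π = (0 < l) × (l ≤ k) × (π (l ∸ 1) ≡ π k)
                 × (∀ m → π (suc k + m) ≡ π (l + m))

  _,_⊨nl[_]_ : (ℕ → State) → ℕ → ℕ → LTL AP → Set
  π , i ⊨nl[ k ] atom p    = L (π i) p ≡ true
  π , i ⊨nl[ k ] natom p   = L (π i) p ≡ false
  π , i ⊨nl[ k ] (φ ∧ₗ ψ)  = (π , i ⊨nl[ k ] φ) × (π , i ⊨nl[ k ] ψ)
  π , i ⊨nl[ k ] (φ ∨ₗ ψ)  = (π , i ⊨nl[ k ] φ) ⊎ (π , i ⊨nl[ k ] ψ)
  π , i ⊨nl[ k ] Xₗ φ      = (i < k) × (π , suc i ⊨nl[ k ] φ)
  π , i ⊨nl[ k ] (φ Uₗ ψ)  = ∃ λ j → i ≤ j × j ≤ k × (π , j ⊨nl[ k ] ψ)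
                               × (∀ m → i ≤ m → m < j → π , m ⊨nl[ k ] φ)
  π , i ⊨nl[ k ] (φ Rₗ ψ)  = ∃ λ j → i ≤ j × j ≤ k × (π , j ⊨nl[ k ] φ)
                               × (∀ m → i ≤ m → m ≤ j → π , m ⊨nl[ k ] ψ)

  _⊨[_]_ : (ℕ → State) → ℕ → LTL AP → Set
  π ⊨[ k ] ψ = (∃ λ l → IsLoop k l π × (π , 0 ⊨ ψ)) ⊎ (π , 0 ⊨nl[ k ] ψ)

-- A propositional assignment gives values to
-- the state-variable copies s_0,…,s_k, to l_0,…,l_k, InLoop_0,…,InLoop_k
-- and LoopExists (indices beyond k are present but never used).

record Assignment (n : ℕ) : Set where
  field
    st         : ℕ → Vec Bool n
    lv         : ℕ → Bool
    inLoop     : ℕ → Bool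
    loopExists : Bool

_⇒ᵇ_ : Bool → Bool → Bool
a ⇒ᵇ b = not a ∨ b

_⇔ᵇ_ : Bool → Bool → Bool
a ⇔ᵇ b = not (a xor b)

andUpTo : ℕ → (ℕ → Bool) → Bool
andUpTo zero    f = true
andUpTo (suc m) f = andUpTo m f ∧ f m

orUpTo : ℕ → (ℕ → Bool) → Bool
orUpTo zero    f = false
orUpTo (suc m) f = orUpTo m f ∨ f m

module Encoding {AP : Set} (M : Kripke AP) (k : ℕ) (a : Assignment (Kripke.n M)) where
  open Kripke M
  open Assignment a

  stEq : State → State → Bool
  stEq s s' = ⌊ ≡-dec B._≟_ s s' ⌋

  modelC : Bool
  modelC = I (st 0) ∧ andUpTo k (λ m → T (st m) (st (suc m)))

  -- loop constraints (i = suc m ranges over 1..k)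
  loopC : Bool
  loopC = not (lv 0) ∧ not (inLoop 0)
        ∧ andUpTo k (λ m → (lv (suc m) ⇒ᵇ stEq (st m) (st k))
                         ∧ (inLoop (suc m) ⇔ᵇ (inLoop m ∨ lv (suc m)))
                         ∧ (inLoop m ⇒ᵇ not (lv (suc m))))
        ∧ (loopExists ⇔ᵇ inLoop k)

  loopOr : (ℕ → Bool) → Bool
  loopOr g = orUpTo k (λ m → lv (suc m) ∧ g (suc m))

  -- auxiliary translations ⟨⟨ψ₁ U ψ₂⟩⟩_j, ⟨⟨ψ₁ R ψ₂⟩⟩_j; the fuel argument is k ∸ j
  auxU : (ℕ → Bool) → (ℕ → Bool) → ℕ → ℕ → Bool
  auxU f g zero    j = g j
  auxU f g (suc r) j = g j ∨ (f j ∧ auxU f g r (suc j))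

  auxR : (ℕ → Bool) → (ℕ → Bool) → ℕ → ℕ → Bool
  auxR f g zero    j = g j
  auxR f g (suc r) j = g j ∧ (f j ∨ auxR f g r (suc j))

  -- [[ψ₁ U ψ₂]]_i and [[ψ₁ R ψ₂]]_i given [[ψ₁]]_· = f, [[ψ₂]]_· = g;
  -- the fuel argument is k ∸ i (fuel 0 is the case i = k)
  trU : (ℕ → Bool) → (ℕ → Bool) → ℕ → ℕ → Bool
  trU f g zero    i = g i ∨ (f i ∧ loopOr (λ j → auxU f g (k ∸ j) j))
  trU f g (suc r) i = g i ∨ (f i ∧ trU f g r (suc i))

  trR : (ℕ → Bool) → (ℕ → Bool) → ℕ → ℕ → Bool
  trR f g zero    i = g i ∧ (f i ∨ loopOr (λ j → auxR f g (k ∸ j) j))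
  trR f g (suc r) i = g i ∧ (f i ∨ trR f g r (suc i))

  tr : LTL AP → ℕ → Bool
  tr (atom p)   i = L (st i) p
  tr (natom p)  i = not (L (st i) p)
  tr (φ ∧ₗ ψ)   i = tr φ i ∧ tr ψ i
  tr (φ ∨ₗ ψ)   i = tr φ i ∨ tr ψ i
  tr (Xₗ φ)     i = if i <ᵇ k then tr φ (suc i) else loopOr (tr φ)
  tr (φ Uₗ ψ)   i = trU (tr φ) (tr ψ) (k ∸ i) i
  tr (φ Rₗ ψ)   i = trR (tr φ) (tr ψ) (k ∸ i) i

  encoding : LTL AP → Bool
  encoding ψ = modelC ∧ loopC ∧ tr ψ 0

Satisfiable : {AP : Set} → Kripke AP → LTL AP → ℕ → Set
Satisfiable M ψ k = ∃ λ (a : Assignment (Kripke.n M)) → Encoding.encoding M k a ψ ≡ true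

-- The translation [[φ]]ᵢ unrolls the fixpoint laws of U and R. On a (k,l)-lasso whose loop
-- start is marked by the l-variables it therefore reflects the truth of φ at every i ≤ k, and
-- with no loop marked it reflects the no-loop bounded semantics; this gives soundness and
-- bounded completeness. For completeness, label a path satisfying ψ (classically) with the
-- truth values of all subformulas. Between two positions carrying the same state and labels,
-- with every pending eventuality discharged in between, the labelled path closes into a
-- locally consistent lasso on which every eventuality is discharged infinitely often, so the
-- lasso satisfies ψ; removing cycles bounds its length by a constant depending only on M and ψ.
-- Satisfying assignments of that bounded shape form a decidable family, which lets the
-- classical step be eliminated.

module Submission where

open import Defs
open import Data.Bool as Bool using (Bool; true; false; not; _∧_; _∨_; if_then_else_)
open import Data.Bool.Properties using (∧-zeroʳ; ∨-identityʳ; ∨-zeroʳ; ∧-identityʳ)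
open import Data.Fin using (Fin; zero; suc; toℕ; fromℕ<; _↑ˡ_; _↑ʳ_)
import Data.Fin.Properties as Fin
open import Data.List as List using (List; []; _∷_; length; cartesianProduct; cartesianProductWith)
open import Data.List.Membership.Propositional using (_∈_; find; lose)
open import Data.List.Membership.Propositional.Properties using (∈-cartesianProduct⁺; ∈-cartesianProductWith⁺)
open import Data.List.Relation.Unary.Any using (here; there; index; any?)
open import Data.List.Relation.Unary.Any.Properties using (lookup-index)
open import Data.Nat
  using (ℕ; zero; suc; _+_; _∸_; _*_; _⊔_; _⊓_; _≤_; _<_; _≤?_; z≤n; s≤s; _<ᵇ_; _≤ᵇ_; _≡ᵇ_)
open import Data.Nat.Induction using (<-rec)
open import Data.Nat.Properties
open import Data.Product using (Σ; ∃; ∃₂; _×_; _,_; proj₁; proj₂)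
open import Data.Sum using (_⊎_; inj₁; inj₂; [_,_]′)
open import Data.Unit using (⊤; tt)
open import Data.Vec as Vec using (Vec; []; _∷_; _++_)
open import Data.Vec.Properties using (≡-dec; lookup-zipWith; lookup-++ˡ; lookup-++ʳ; lookup∘tabulate)
open import Data.Vec.Relation.Binary.Pointwise.Inductive as Pointwise using (Pointwise; []; _∷_; ++⁺)
open import Effect.Monad using (RawMonad)
open import Function using (id; _∘_; _⇔_; mk⇔)
open import Level using (0ℓ)
open import Relation.Binary.Definitions using (tri<; tri≈; tri>)
open import Relation.Binary.PropositionalEquality
open import Relation.Nullary using (¬_; Dec; yes; no; does; proof; _because_; contradiction)
open import Relation.Nullary.Decidable using (map′; ¬¬-excluded-middle; decidable-stable)
open import Relation.Nullary.Negation using (¬¬-Monad; ¬¬-map)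
open import Relation.Nullary.Reflects

open RawMonad (¬¬-Monad {0ℓ}) using (return; _>>=_)

map-reflects : ∀ {A B : Set} {b} → (A → B) → (B → A) → Reflects A b → Reflects B b
map-reflects f g (ofʸ a)  = ofʸ (f a)
map-reflects f g (ofⁿ ¬a) = ofⁿ (¬a ∘ g)

≡true-reflects : ∀ b → Reflects (b ≡ true) b
≡true-reflects true  = ofʸ refl
≡true-reflects false = ofⁿ (λ ())

≡false-reflects : ∀ b → Reflects (b ≡ false) (not b)
≡false-reflects true  = ofⁿ (λ ())
≡false-reflects false = ofʸ refl

true⇒reflected : ∀ {A : Set} {b} → Reflects A b → b ≡ true → A
true⇒reflected (ofʸ a) _ = a

reflected⇒true : ∀ {A : Set} {b} → Reflects A b → A → b ≡ true
reflected⇒true (ofʸ _)  _ = refl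
reflected⇒true (ofⁿ ¬a) a = contradiction a ¬a

unreflected⇒false : ∀ {A : Set} {b} → Reflects A b → ¬ A → b ≡ false
unreflected⇒false (ofʸ a) ¬a = contradiction a ¬a
unreflected⇒false (ofⁿ _) _  = refl

≡ᵇ-reflects-≡ : ∀ m n → Reflects (m ≡ n) (m ≡ᵇ n)
≡ᵇ-reflects-≡ m n = fromEquivalence (≡ᵇ⇒≡ m n) (≡⇒≡ᵇ m n)

⇔ᵇ-reflects : ∀ x y → Reflects (x ≡ y) (x ⇔ᵇ y)
⇔ᵇ-reflects true  true  = ofʸ refl
⇔ᵇ-reflects true  false = ofⁿ (λ ())
⇔ᵇ-reflects false true  = ofⁿ (λ ())
⇔ᵇ-reflects false false = ofʸ refl

andUpTo-reflects : ∀ {P : ℕ → Set} {f} k → (∀ m → m < k → Reflects (P m) (f m)) →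
                   Reflects (∀ m → m < k → P m) (andUpTo k f)
andUpTo-reflects zero    _ = ofʸ (λ _ ())
andUpTo-reflects {P} (suc k) r =
  map-reflects join split (andUpTo-reflects k (λ m m<k → r m (m<n⇒m<1+n m<k)) ×-reflects r k ≤-refl)
  where
  join : (∀ m → m < k → P m) × P k → ∀ m → m < suc k → P m
  join (ps , pk) m m<1+k with m<1+n⇒m<n∨m≡n m<1+k
  ... | inj₁ m<k  = ps m m<k
  ... | inj₂ refl = pk
  split : (∀ m → m < suc k → P m) → (∀ m → m < k → P m) × P k
  split ps = (λ m m<k → ps m (m<n⇒m<1+n m<k)) , ps k ≤-refl

orUpTo-reflects : ∀ {P : ℕ → Set} {f} k → (∀ m → m < k → Reflects (P m) (f m)) →
                  Reflects (∃ λ m → m < k × P m) (orUpTo k f)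
orUpTo-reflects zero    _ = ofⁿ λ ()
orUpTo-reflects {P} (suc k) r =
  map-reflects join split (orUpTo-reflects k (λ m m<k → r m (m<n⇒m<1+n m<k)) ⊎-reflects r k ≤-refl)
  where
  join : (∃ λ m → m < k × P m) ⊎ P k → ∃ λ m → m < suc k × P m
  join (inj₁ (m , m<k , pm)) = m , m<n⇒m<1+n m<k , pm
  join (inj₂ pk)             = k , ≤-refl , pk
  split : (∃ λ m → m < suc k × P m) → (∃ λ m → m < k × P m) ⊎ P k
  split (m , m<1+k , pm) with m<1+n⇒m<n∨m≡n m<1+k
  ... | inj₁ m<k  = inj₁ (m , m<k , pm)
  ... | inj₂ refl = inj₂ pm

offset : ∀ {i m} → i ≤ m → ∃ λ d → m ≡ i + d
offset i≤m = _ , sym (m+[n∸m]≡n i≤m)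

offsetʳ : ∀ {i m} → i ≤ m → ∃ λ d → m ≡ d + i
offsetʳ i≤m = _ , sym (m∸n+n≡m i≤m)

interval-∷ : ∀ {R B : ℕ → Set} {i} → R i → (∀ m → suc i ≤ m → B m → R m) →
             ∀ m → i ≤ m → B m → R m
interval-∷ r rs m i≤m bm with m≤n⇒m<n∨m≡n i≤m
... | inj₁ i<m  = rs m i<m bm
... | inj₂ refl = r

-- The clauses of U and R in the semantics: π ^ i ⊨ φ Uₗ ψ is by definition
-- Until (π ^_⊨ φ) (π ^_⊨ ψ) i. StrongRelease has the shape of the no-loop clause of R.
module _ (P Q : ℕ → Set) where

  Until : ℕ → Set
  Until i = ∃ λ j → i ≤ j × Q j × (∀ m → i ≤ m → m < j → P m)

  Release : ℕ → Set
  Release i = ∀ j → i ≤ j → Q j ⊎ ∃ λ m → i ≤ m × m < j × P m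

  StrongRelease : ℕ → Set
  StrongRelease i = ∃ λ j → i ≤ j × P j × (∀ m → i ≤ m → m ≤ j → Q m)

module _ {P Q : ℕ → Set} where

  Until-here : ∀ {i} → Q i → Until P Q i
  Until-here q = _ , ≤-refl , q , λ m i≤m m<i → contradiction m<i (≤⇒≯ i≤m)

  Until-step : ∀ {i} → P i → Until P Q (suc i) → Until P Q i
  Until-step p (j , i<j , qj , ps) = j , <⇒≤ i<j , qj , interval-∷ p ps

  -- The fixpoint unfoldings performed by the translation, stated for reflected truth
  -- values so that both directions of its correctness come at once.
  until-unfold : ∀ {i b₁ b₂ b₃} → Reflects (Q i) b₁ → Reflects (P i) b₂ →
                 Reflects (Until P Q (suc i)) b₃ → Reflects (Until P Q i) (b₁ ∨ (b₂ ∧ b₃))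
  until-unfold (ofʸ q) _ _ = ofʸ (Until-here q)
  until-unfold (ofⁿ ¬q) (ofʸ p) (ofʸ u) = ofʸ (Until-step p u)
  until-unfold {i} (ofⁿ ¬q) (ofʸ p) (ofⁿ ¬u) = ofⁿ later
    where
    later : ¬ Until P Q i
    later (j , i≤j , qj , ps) with m≤n⇒m<n∨m≡n i≤j
    ... | inj₁ i<j  = ¬u (j , i<j , qj , λ m i<m → ps m (<⇒≤ i<m))
    ... | inj₂ refl = ¬q qj
  until-unfold {i} (ofⁿ ¬q) (ofⁿ ¬p) _ = ofⁿ now
    where
    now : ¬ Until P Q i
    now (j , i≤j , qj , ps) with m≤n⇒m<n∨m≡n i≤j
    ... | inj₁ i<j  = ¬p (ps i ≤-refl i<j)
    ... | inj₂ refl = ¬q qj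

  release-unfold : ∀ {i b₁ b₂ b₃} → Reflects (Q i) b₁ → Reflects (P i) b₂ →
                   Reflects (Release P Q (suc i)) b₃ → Reflects (Release P Q i) (b₁ ∧ (b₂ ∨ b₃))
  release-unfold {i} (ofⁿ ¬q) _ _ = ofⁿ now
    where
    now : ¬ Release P Q i
    now r with r i ≤-refl
    ... | inj₁ q = ¬q q
    ... | inj₂ (m , i≤m , m<i , _) = ≤⇒≯ i≤m m<i
  release-unfold {i} (ofʸ q) (ofʸ p) _ = ofʸ released
    where
    released : Release P Q i
    released j i≤j with m≤n⇒m<n∨m≡n i≤j
    ... | inj₁ i<j  = inj₂ (i , ≤-refl , i<j , p)
    ... | inj₂ refl = inj₁ q
  release-unfold {i} (ofʸ q) (ofⁿ ¬p) (ofʸ r) = ofʸ released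
    where
    released : Release P Q i
    released j i≤j with m≤n⇒m<n∨m≡n i≤j
    ... | inj₂ refl = inj₁ q
    ... | inj₁ i<j with r j i<j
    ...   | inj₁ qj = inj₁ qj
    ...   | inj₂ (m , i<m , m<j , pm) = inj₂ (m , <⇒≤ i<m , m<j , pm)
  release-unfold {i} (ofʸ q) (ofⁿ ¬p) (ofⁿ ¬r) = ofⁿ λ r → ¬r (later r)
    where
    later : Release P Q i → Release P Q (suc i)
    later r j i<j with r j (<⇒≤ i<j)
    ... | inj₁ qj = inj₁ qj
    ... | inj₂ (m , i≤m , m<j , pm) with m≤n⇒m<n∨m≡n i≤m
    ...   | inj₁ i<m  = inj₂ (m , i<m , m<j , pm)
    ...   | inj₂ refl = contradiction pm ¬p

  strongRelease-unfold : ∀ {i b₁ b₂ b₃} → Reflects (Q i) b₁ → Reflects (P i) b₂ →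
                         Reflects (StrongRelease P Q (suc i)) b₃ →
                         Reflects (StrongRelease P Q i) (b₁ ∧ (b₂ ∨ b₃))
  strongRelease-unfold (ofⁿ ¬q) _ _ = ofⁿ λ (j , i≤j , _ , qs) → ¬q (qs _ ≤-refl i≤j)
  strongRelease-unfold {i} (ofʸ q) (ofʸ p) _ =
    ofʸ (i , ≤-refl , p , λ m i≤m m≤i → subst Q (≤-antisym i≤m m≤i) q)
  strongRelease-unfold (ofʸ q) (ofⁿ ¬p) (ofʸ (j , i<j , pj , qs)) = ofʸ (j , <⇒≤ i<j , pj , interval-∷ q qs)
  strongRelease-unfold {i} (ofʸ q) (ofⁿ ¬p) (ofⁿ ¬s) = ofⁿ later
    where
    later : ¬ StrongRelease P Q i
    later (j , i≤j , pj , qs) with m≤n⇒m<n∨m≡n i≤j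
    ... | inj₁ i<j  = ¬s (j , i<j , pj , λ m i<m → qs m (<⇒≤ i<m))
    ... | inj₂ refl = ¬p pj

module _ {P Q P′ Q′ : ℕ → Set} (f : ∀ {m} → P m → P′ m) (g : ∀ {m} → Q m → Q′ m) where

  Until-map : ∀ {i} → Until P Q i → Until P′ Q′ i
  Until-map (j , i≤j , qj , ps) = j , i≤j , g qj , λ m i≤m m<j → f (ps m i≤m m<j)

  Release-map : ∀ {i} → Release P Q i → Release P′ Q′ i
  Release-map r j i≤j with r j i≤j
  ... | inj₁ qj = inj₁ (g qj)
  ... | inj₂ (m , i≤m , m<j , pm) = inj₂ (m , i≤m , m<j , f pm)

module _ {P Q P′ Q′ : ℕ → Set} {i j : ℕ}
         (f : ∀ d → P (i + d) → P′ (j + d)) (g : ∀ d → Q (i + d) → Q′ (j + d)) where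

  Until-shift : Until P Q i → Until P′ Q′ j
  Until-shift (w , i≤w , qw , ps) with offset i≤w
  ... | d , refl = j + d , m≤m+n j d , g d qw , before
    where
    before : ∀ m → j ≤ m → m < j + d → P′ m
    before m j≤m m<jd with offset j≤m
    ... | e , refl = f e (ps (i + e) (m≤m+n i e) (+-monoʳ-< i (+-cancelˡ-< j e d m<jd)))

  Release-shift : Release P Q i → Release P′ Q′ j
  Release-shift r m j≤m with offset j≤m
  ... | e , refl with r (i + e) (m≤m+n i e)
  ...   | inj₁ q = inj₁ (g e q)
  ...   | inj₂ (m′ , i≤m′ , m′<ie , p) with offset i≤m′
  ...     | d , refl = inj₂ (j + d , m≤m+n j d , +-monoʳ-< j (+-cancelˡ-< i d e m′<ie) , f d p)

StrongRelease⇒Release : ∀ {P Q i} → StrongRelease P Q i → Release P Q i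
StrongRelease⇒Release (j , i≤j , pj , qs) m i≤m with m ≤? j
... | yes m≤j = inj₁ (qs m i≤m m≤j)
... | no m≰j  = inj₂ (j , i≤j , ≰⇒> m≰j , pj)

-- The operators restricted to positions ≤ k: the auxiliary translations ⟨⟨·⟩⟩ and the
-- no-loop semantics of U and R.
module _ (k : ℕ) (P Q : ℕ → Set) where

  UntilWithin : ℕ → Set
  UntilWithin = Until P (λ j → j ≤ k × Q j)

  ReleaseWithin : ℕ → Set
  ReleaseWithin = Release P (λ j → k < j ⊎ Q j)

  StrongReleaseWithin : ℕ → Set
  StrongReleaseWithin = StrongRelease (λ j → j ≤ k × P j) Q

module _ {k : ℕ} {P Q : ℕ → Set} where

  untilWithin-beyond : ¬ UntilWithin k P Q (suc k)
  untilWithin-beyond (j , k<j , (j≤k , _) , _) = <⇒≱ k<j j≤k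

  releaseWithin-beyond : ReleaseWithin k P Q (suc k)
  releaseWithin-beyond j k<j = inj₁ (inj₁ k<j)

  strongReleaseWithin-beyond : ¬ StrongReleaseWithin k P Q (suc k)
  strongReleaseWithin-beyond (j , k<j , (j≤k , _) , _) = <⇒≱ k<j j≤k

  module _ {m : ℕ} {b₁ b₂ b₃ : Bool} (m≤k : m ≤ k) (q : Reflects (Q m) b₁) (p : Reflects (P m) b₂) where

    untilWithin-unfold : Reflects (UntilWithin k P Q (suc m)) b₃ →
                         Reflects (UntilWithin k P Q m) (b₁ ∨ (b₂ ∧ b₃))
    untilWithin-unfold = until-unfold (map-reflects (m≤k ,_) proj₂ q) p

    releaseWithin-unfold : Reflects (ReleaseWithin k P Q (suc m)) b₃ →
                           Reflects (ReleaseWithin k P Q m) (b₁ ∧ (b₂ ∨ b₃))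
    releaseWithin-unfold = release-unfold (map-reflects inj₂ within q) p
      where
      within : k < m ⊎ Q m → Q m
      within (inj₁ k<m) = contradiction m≤k (<⇒≱ k<m)
      within (inj₂ qm)  = qm

    strongReleaseWithin-unfold : Reflects (StrongReleaseWithin k P Q (suc m)) b₃ →
                                 Reflects (StrongReleaseWithin k P Q m) (b₁ ∧ (b₂ ∨ b₃))
    strongReleaseWithin-unfold = strongRelease-unfold q (map-reflects (m≤k ,_) proj₂ p)

module _ {f g r : ℕ → Bool} where

  -- A locally consistent labelling r of an until node may stay true forever; a later
  -- position w where it is discharged forces a witness.
  until-walk : (∀ m → r m ≡ (g m ∨ (f m ∧ r (suc m)))) → ∀ {w} → (not (r w) ∨ g w) ≡ true →
               ∀ d {m} → d + m ≡ w → r m ≡ true → Until (λ m → f m ≡ true) (λ m → g m ≡ true) m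
  until-walk unfold discharge zero refl rm
    with true⇒reflected (≡false-reflects _ ⊎-reflects ≡true-reflects _) discharge
  ... | inj₁ rm≡false = contradiction (trans (sym rm) rm≡false) λ ()
  ... | inj₂ gm       = Until-here gm
  until-walk unfold discharge (suc d) {m} eq rm
    with true⇒reflected (≡true-reflects (g m) ⊎-reflects ≡true-reflects (f m) ×-reflects ≡true-reflects (r (suc m)))
                        (trans (sym (unfold m)) rm)
  ... | inj₁ gm = Until-here gm
  ... | inj₂ (fm , rm′) = Until-step fm (until-walk unfold discharge d (trans (+-suc d m) eq) rm′)

  release-walk : (∀ m → r m ≡ (g m ∧ (f m ∨ r (suc m)))) → ∀ {m} → r m ≡ true →
                 Release (λ m → f m ≡ true) (λ m → g m ≡ true) m
  release-walk unfold {m} rm j m≤j = walk (j ∸ m) (m∸n+n≡m m≤j) rm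
    where
    walk : ∀ d {m} → d + m ≡ j → r m ≡ true → g j ≡ true ⊎ ∃ λ n → m ≤ n × n < j × f n ≡ true
    walk d {m} eq rm
      with true⇒reflected (≡true-reflects (g m) ×-reflects (≡true-reflects (f m) ⊎-reflects ≡true-reflects (r (suc m))))
                          (trans (sym (unfold m)) rm)
    walk zero    refl _ | gm , _ = inj₁ gm
    walk (suc d) {m} eq _ | _ , inj₁ fm = inj₂ (m , ≤-refl , subst (m <_) eq (s≤s (m≤n+m m d)) , fm)
    walk (suc d) {m} eq _ | _ , inj₂ rm′ with walk d (trans (+-suc d m) eq) rm′
    ... | inj₁ gj = inj₁ gj
    ... | inj₂ (n , m<n , n<j , fn) = inj₂ (n , <⇒≤ m<n , n<j , fn)

record SameFrom {A : Set} (π : ℕ → A) (i : ℕ) (π′ : ℕ → A) (j : ℕ) : Set where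
  constructor sameFrom
  field agrees : ∀ t → π (i + t) ≡ π′ (j + t)
open SameFrom

module _ {A : Set} {π π′ : ℕ → A} {i j : ℕ} (same : SameFrom π i π′ j) where

  SameFrom-head : π i ≡ π′ j
  SameFrom-head = trans (cong π (sym (+-identityʳ i))) (trans (agrees same 0) (cong π′ (+-identityʳ j)))

  SameFrom-suc : SameFrom π (suc i) π′ (suc j)
  SameFrom-suc = sameFrom λ t → trans (cong π (sym (+-suc i t))) (trans (agrees same (suc t)) (cong π′ (+-suc j t)))

  SameFrom-shift : ∀ d → SameFrom π (i + d) π′ (j + d)
  SameFrom-shift d = sameFrom λ t →
    trans (cong π (+-assoc i d t)) (trans (agrees same (d + t)) (cong π′ (sym (+-assoc j d t))))

  SameFrom-sym : SameFrom π′ j π i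
  SameFrom-sym = sameFrom λ t → sym (agrees same t)

SameFrom-trans : ∀ {A : Set} {π π′ π″ : ℕ → A} {i j m} →
                 SameFrom π i π′ j → SameFrom π′ j π″ m → SameFrom π i π″ m
SameFrom-trans s s′ = sameFrom λ t → trans (agrees s t) (agrees s′ t)

-- idx t is the position in s₀ … s_k visited at time t by the lasso s₀ … s_{l-1} (s_l … s_k)^ω.
module LassoIndex (k l : ℕ) (l≤k : l ≤ k) where

  next : ℕ → ℕ
  next u = if u <ᵇ k then suc u else l

  idx : ℕ → ℕ
  idx zero    = zero
  idx (suc t) = next (idx t)

  next-< : ∀ {u} → u < k → next u ≡ suc u
  next-< {u} u<k rewrite reflected⇒true (<ᵇ-reflects-< u k) u<k = refl

  next-k : next k ≡ l
  next-k rewrite unreflected⇒false (<ᵇ-reflects-< k k) (<-irrefl refl) = refl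

  idx-≤ : ∀ t → idx t ≤ k
  idx-≤ zero = z≤n
  idx-≤ (suc t) with m≤n⇒m<n∨m≡n (idx-≤ t)
  ... | inj₁ lt = subst (_≤ k) (sym (next-< lt)) lt
  ... | inj₂ eq = subst (_≤ k) (sym (trans (cong next eq) next-k)) l≤k

  idx-prefix : ∀ {u} → u ≤ k → idx u ≡ u
  idx-prefix {zero}  _    = refl
  idx-prefix {suc u} u<k = trans (cong next (idx-prefix (<⇒≤ u<k))) (next-< u<k)

  idx-loop : ∀ m → idx (suc k + m) ≡ idx (l + m)
  idx-loop zero = begin
    idx (suc k + 0)  ≡⟨ cong idx (+-identityʳ (suc k)) ⟩
    next (idx k)     ≡⟨ cong next (idx-prefix ≤-refl) ⟩
    next k           ≡⟨ next-k ⟩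
    l                ≡⟨ sym (idx-prefix l≤k) ⟩
    idx l            ≡⟨ cong idx (sym (+-identityʳ l)) ⟩
    idx (l + 0)      ∎
    where open ≡-Reasoning
  idx-loop (suc m) = begin
    idx (suc k + suc m)     ≡⟨ cong idx (+-suc (suc k) m) ⟩
    next (idx (suc k + m))  ≡⟨ cong next (idx-loop m) ⟩
    next (idx (l + m))      ≡⟨ cong idx (sym (+-suc l m)) ⟩
    idx (l + suc m)         ∎
    where open ≡-Reasoning

  period : ℕ
  period = suc (k ∸ l)

  idx-period : ∀ {w} → l ≤ w → idx (period + w) ≡ idx w
  idx-period l≤w with offset l≤w
  ... | d , refl = trans (cong idx shift) (idx-loop d)
    where
    shift : period + (l + d) ≡ suc k + d
    shift = begin
      period + (l + d)  ≡⟨ sym (+-assoc period l d) ⟩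
      period + l + d    ≡⟨ cong (_+ d) (+-comm period l) ⟩
      l + period + d    ≡⟨ cong (_+ d) (trans (+-suc l (k ∸ l)) (cong suc (m+[n∸m]≡n l≤k))) ⟩
      suc k + d         ∎
      where open ≡-Reasoning

  idx-recurrent : ∀ {u} → l ≤ u → u ≤ k → ∀ q → ∃ λ w → q ≤ w × idx w ≡ u
  idx-recurrent {u} l≤u u≤k q = q * period + u , ≤-trans (m≤m*n q period) (m≤m+n _ u) , revisit q
    where
    revisit : ∀ q → idx (q * period + u) ≡ u
    revisit zero    = idx-prefix u≤k
    revisit (suc q) = begin
      idx (period + q * period + u)    ≡⟨ cong idx (+-assoc period (q * period) u) ⟩
      idx (period + (q * period + u))  ≡⟨ idx-period (≤-trans l≤u (m≤n+m u (q * period))) ⟩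
      idx (q * period + u)             ≡⟨ revisit q ⟩
      u                                ∎
      where open ≡-Reasoning

  unroll-step : ∀ {A : Set} (E : A → A → Set) (α : ℕ → A) → (∀ u → u < k → E (α u) (α (suc u))) →
                E (α k) (α l) → ∀ t → E (α (idx t)) (α (idx (suc t)))
  unroll-step E α walk back t with m≤n⇒m<n∨m≡n (idx-≤ t)
  ... | inj₁ lt = subst (E (α (idx t)) ∘ α) (sym (next-< lt)) (walk _ lt)
  ... | inj₂ eq rewrite eq | next-k = back

module _ {A : Set} where

  splice : ℕ → (ℕ → A) → (ℕ → A) → ℕ → A
  splice r u w q = if q ≤ᵇ r then u q else w (q ∸ suc r)

  splice-≤ : ∀ r u w {q} → q ≤ r → splice r u w q ≡ u q
  splice-≤ r u w {q} q≤r rewrite reflected⇒true (≤ᵇ-reflects-≤ q r) q≤r = refl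

  splice-> : ∀ r u w d → splice r u w (d + suc r) ≡ w d
  splice-> r u w d rewrite unreflected⇒false (≤ᵇ-reflects-≤ (d + suc r) r) (<⇒≱ (m≤n+m (suc r) d))
                         | m+n∸n≡m d (suc r) = refl

record Finite (A : Set) : Set where
  field
    elements : List A
    complete : ∀ x → x ∈ elements

  size : ℕ
  size = length elements
open Finite

finite-⊤ : Finite ⊤
finite-⊤ = record { elements = tt ∷ [] ; complete = λ _ → here refl }

finite-Bool : Finite Bool
finite-Bool = record
  { elements = true ∷ false ∷ []
  ; complete = λ { true → here refl ; false → there (here refl) }
  }

finite-× : ∀ {A B : Set} → Finite A → Finite B → Finite (A × B)
finite-× FA FB = record
  { elements = cartesianProduct (elements FA) (elements FB)
  ; complete = λ (x , y) → ∈-cartesianProduct⁺ (complete FA x) (complete FB y)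
  }

finite-Vec : ∀ {A : Set} → Finite A → ∀ m → Finite (Vec A m)
finite-Vec FA zero    = record { elements = [] ∷ [] ; complete = λ { [] → here refl } }
finite-Vec FA (suc m) = record
  { elements = cartesianProductWith _∷_ (elements FA) (elements (finite-Vec FA m))
  ; complete = λ { (x ∷ xs) → ∈-cartesianProductWith⁺ _∷_ (complete FA x) (complete (finite-Vec FA m) xs) }
  }

∃?-finite : ∀ {A : Set} {P : A → Set} → Finite A → (∀ x → Dec (P x)) → Dec (∃ P)
∃?-finite F P? = map′ (λ any → let x , _ , px = find any in x , px)
                      (λ (x , px) → lose (complete F x) px)
                      (any? P? (elements F))

pigeonhole-ℕ : ∀ {A : Set} (F : Finite A) (f : ℕ → A) → ∃₂ λ a b → a < b × b ≤ size F × f a ≡ f b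
pigeonhole-ℕ F f with Fin.pigeonhole (n<1+n (size F)) (λ i → index (complete F (f (toℕ i))))
... | i , j , i<j , same = toℕ i , toℕ j , i<j , ≤-pred (Fin.toℕ<n j) , (begin
  f (toℕ i)                                         ≡⟨ lookup-index (complete F (f (toℕ i))) ⟩
  List.lookup (elements F) (index (complete F (f (toℕ i))))  ≡⟨ cong (List.lookup (elements F)) same ⟩
  List.lookup (elements F) (index (complete F (f (toℕ j))))  ≡⟨ lookup-index (complete F (f (toℕ j))) ⟨
  f (toℕ j)                                         ∎)
  where open ≡-Reasoning

module _ {A : Set} (E : A → A → Set) where

  Walk : (ℕ → A) → ℕ → Set
  Walk w m = ∀ x → x < m → E (w x) (w (suc x))

  Walk-splice : ∀ {u w r m} → Walk u r → E (u r) (w 0) → Walk w m → Walk (splice r u w) (m + suc r)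
  Walk-splice {u} {w} {r} walk-u bridge walk-w q q<m+1+r with <-cmp q r
  ... | tri< q<r _ _  = subst₂ E (sym (splice-≤ r u w (<⇒≤ q<r))) (sym (splice-≤ r u w q<r)) (walk-u q q<r)
  ... | tri≈ _ refl _ = subst₂ E (sym (splice-≤ r u w ≤-refl)) (sym (splice-> r u w 0)) bridge
  ... | tri> _ _ r<q with offsetʳ r<q
  ...   | d , refl = subst₂ E (sym (splice-> r u w d)) (sym (splice-> r u w (suc d)))
                             (walk-w d (+-cancelʳ-< (suc r) d _ q<m+1+r))

  module _ (F : Finite A) where

    ShortWalk : (ℕ → A) → ℕ → Set
    ShortWalk w m = ∃₂ λ m′ w′ → m′ ≤ size F × w′ 0 ≡ w 0 × w′ m′ ≡ w m × Walk w′ m′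

    shorten : ∀ m {w} → Walk w m → ShortWalk w m
    shorten = <-rec (λ m → ∀ {w} → Walk w m → ShortWalk w m) cut
      where
      cut : ∀ m → (∀ {m₀} → m₀ < m → ∀ {w} → Walk w m₀ → ShortWalk w m₀) →
            ∀ {w} → Walk w m → ShortWalk w m
      cut m rec {w} walk with m ≤? size F
      ... | yes m≤size = m , w , m≤size , refl , refl , walk
      ... | no m≰size with pigeonhole-ℕ F w
      ...   | a , b , a<b , b≤size , wa≡wb with offset (<⇒≤ a<b)
      ...     | d , refl = result (rec m∸d<m skip-walk)
        where
        b<m : a + d < m
        b<m = ≤-<-trans b≤size (≰⇒> m≰size)
        d≤m : d ≤ m
        d≤m = ≤-trans (m≤n+m d a) (<⇒≤ b<m)
        0<d : 0 < d
        0<d = +-cancelˡ-< a 0 d (subst (_< a + d) (sym (+-identityʳ a)) a<b)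
        m∸d<m : m ∸ d < m
        m∸d<m = ∸-monoʳ-< 0<d d≤m
        a<m∸d : a < m ∸ d
        a<m∸d = +-cancelʳ-< d a (m ∸ d) (subst (a + d <_) (sym (m∸n+n≡m d≤m)) b<m)
        skipped : ℕ → A
        skipped x = if x ≤ᵇ a then w x else w (x + d)
        skipped-≤ : ∀ {x} → x ≤ a → skipped x ≡ w x
        skipped-≤ {x} x≤a rewrite reflected⇒true (≤ᵇ-reflects-≤ x a) x≤a = refl
        skipped-> : ∀ {x} → a < x → skipped x ≡ w (x + d)
        skipped-> {x} a<x rewrite unreflected⇒false (≤ᵇ-reflects-≤ x a) (<⇒≱ a<x) = refl
        skip-walk : Walk skipped (m ∸ d)
        skip-walk x x<m∸d with <-cmp x a
        ... | tri< x<a _ _ = subst₂ E (sym (skipped-≤ (<⇒≤ x<a))) (sym (skipped-≤ x<a))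
                               (walk x (<-trans x<a (<-trans a<b b<m)))
        ... | tri≈ _ refl _ = subst₂ E (sym (trans (skipped-≤ ≤-refl) wa≡wb)) (sym (skipped-> ≤-refl))
                                (walk (x + d) b<m)
        ... | tri> _ _ a<x = subst₂ E (sym (skipped-> a<x)) (sym (skipped-> (<-trans a<x (n<1+n x))))
                               (walk (x + d) (subst (x + d <_) (m∸n+n≡m d≤m) (+-monoˡ-< d x<m∸d)))
        result : ShortWalk skipped (m ∸ d) → ShortWalk w m
        result (m′ , w′ , m′≤size , start , end , walk′) =
          m′ , w′ , m′≤size , start , trans end (trans (skipped-> a<m∸d) (cong w (m∸n+n≡m d≤m))) , walk′

-- Indices beyond k read entry k.
at : ∀ {A : Set} {k} → Vec A (suc k) → ℕ → A
at {k = k} v u = Vec.lookup v (fromℕ< (s≤s (m⊓n≤n u k)))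

at-tabulate : ∀ {A : Set} {k} (f : ℕ → A) {u} → u ≤ k → at (Vec.tabulate {n = suc k} (f ∘ toℕ)) u ≡ f u
at-tabulate {k = k} f {u} u≤k =
  trans (lookup∘tabulate (f ∘ toℕ) _)
        (cong f (trans (Fin.toℕ-fromℕ< (s≤s (m⊓n≤n u k))) (m≤n⇒m⊓n≡m u≤k)))

record Fair {c} (v : ℕ → Vec Bool c) : Set where
  constructor fair
  field often : ∀ ι q → ∃ λ w → q ≤ w × Vec.lookup (v w) ι ≡ true
open Fair

Fair-∷ : ∀ {c} {b : ℕ → Bool} {v : ℕ → Vec Bool c} → Fair (λ t → b t ∷ v t) →
         (∀ q → ∃ λ w → q ≤ w × b w ≡ true) × Fair v
Fair-∷ bv = often bv zero , fair λ ι → often bv (suc ι)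

Fair-++ : ∀ {c c′} {u : ℕ → Vec Bool c} {v : ℕ → Vec Bool c′} →
          Fair (λ t → u t ++ v t) → Fair u × Fair v
Fair-++ {c} {c′} {u} {v} uv = fair left , fair right
  where
  left : ∀ ι q → ∃ λ w → q ≤ w × Vec.lookup (u w) ι ≡ true
  left ι q = let w , q≤w , bit = often uv (ι ↑ˡ c′) q in w , q≤w , trans (sym (lookup-++ˡ (u w) (v w) ι)) bit
  right : ∀ ι q → ∃ λ w → q ≤ w × Vec.lookup (v w) ι ≡ true
  right ι q = let w , q≤w , bit = often uv (c ↑ʳ ι) q in w , q≤w , trans (sym (lookup-++ʳ (u w) (v w) ι)) bit

module _ {c : ℕ} where

  accumulated : (ℕ → Vec Bool c) → ℕ → Vec Bool c
  accumulated v zero    = v 0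
  accumulated v (suc d) = Vec.zipWith _∨_ (accumulated v d) (v (suc d))

  accumulated-lookup : ∀ v d ι →
                       Vec.lookup (accumulated v d) ι ≡ orUpTo (suc d) (λ d′ → Vec.lookup (v d′) ι)
  accumulated-lookup v zero    ι = refl
  accumulated-lookup v (suc d) ι =
    trans (lookup-zipWith _∨_ ι (accumulated v d) (v (suc d)))
          (cong (_∨ Vec.lookup (v (suc d)) ι) (accumulated-lookup v d ι))

  accumulated-unique : ∀ {e} (acc v : ℕ → Vec Bool c) → acc 0 ≡ v 0 →
                       (∀ d → d < e → acc (suc d) ≡ Vec.zipWith _∨_ (acc d) (v (suc d))) →
                       ∀ d → d ≤ e → acc d ≡ accumulated v d
  accumulated-unique acc v start step zero    _   = start
  accumulated-unique acc v start step (suc d) d<e =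
    trans (step d d<e)
          (cong (λ a → Vec.zipWith _∨_ a (v (suc d))) (accumulated-unique acc v start step d (<⇒≤ d<e)))

  accumulated-reflects : ∀ v d ι →
                         Reflects (∃ λ d′ → d′ ≤ d × Vec.lookup (v d′) ι ≡ true) (Vec.lookup (accumulated v d) ι)
  accumulated-reflects v d ι rewrite accumulated-lookup v d ι =
    map-reflects (λ (d′ , d′<1+d , bit) → d′ , ≤-pred d′<1+d , bit)
                 (λ (d′ , d′≤d , bit) → d′ , s≤s d′≤d , bit)
                 (orUpTo-reflects (suc d) λ _ _ → ≡true-reflects _)

¬¬-iterate : ∀ {R : ℕ → ℕ → Set} → (∀ x → ¬ ¬ ∃ (R x)) →
             ∀ N x → ¬ ¬ ∃ λ (p : ℕ → ℕ) → p 0 ≡ x × ∀ i → i < N → R (p i) (p (suc i))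
¬¬-iterate step zero    x = return ((λ _ → x) , refl , λ _ ())
¬¬-iterate {R} step (suc N) x = do
  y , rxy ← step x
  p , p₀ , rs ← ¬¬-iterate step N y
  return ( (λ { zero → x ; (suc i) → p i }) , refl
         , λ { zero _ → subst (R x) (sym p₀) rxy ; (suc i) i<N → rs i (≤-pred i<N) })

¬¬-bound : ∀ {c} {O : Fin c → ℕ → Set} x → (∀ ι → ¬ ¬ ∃ λ w → x ≤ w × O ι w) →
           ¬ ¬ ∃ λ B → x < B × ∀ ι → ∃ λ w → x ≤ w × w ≤ B × O ι w
¬¬-bound {zero}  x _   = return (suc x , ≤-refl , λ ())
¬¬-bound {suc c} x obl = do
  w₀ , x≤w₀ , o₀ ← obl zero
  B , x<B , os ← ¬¬-bound x (obl ∘ suc)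
  return ( w₀ ⊔ B , <-≤-trans x<B (m≤n⊔m w₀ B)
         , λ { zero → w₀ , x≤w₀ , m≤m⊔n w₀ B , o₀
             ; (suc ι) → let w , x≤w , w≤B , o = os ι in w , x≤w , ≤-trans w≤B (m≤n⊔m w₀ B) , o })

¬¬-∀≤ : ∀ {Q : ℕ → Set} → (∀ t → ¬ ¬ Q t) → ∀ B → ¬ ¬ (∀ t → t ≤ B → Q t)
¬¬-∀≤ {Q} q zero    = ¬¬-map (λ q₀ t t≤0 → subst Q (sym (n≤0⇒n≡0 t≤0)) q₀) (q 0)
¬¬-∀≤ {Q} q (suc B) = do
  qs ← ¬¬-∀≤ q B
  qB ← q (suc B)
  return λ t t≤1+B → [ (λ t<1+B → qs t (≤-pred t<1+B)) , (λ t≡1+B → subst Q (sym t≡1+B) qB) ]′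
                       (m≤n⇒m<n∨m≡n t≤1+B)

¬¬-choice≤ : ∀ {A : Set} {P : ℕ → A → Set} → (∀ t → ¬ ¬ Σ A (P t)) → ∀ B →
             ¬ ¬ ∃ λ (f : ℕ → A) → ∀ t → t ≤ B → P t (f t)
¬¬-choice≤ {A} {P} choose B = ¬¬-map pick (¬¬-∀≤ choose B)
  where
  pick : (∀ t → t ≤ B → Σ A (P t)) → ∃ λ (f : ℕ → A) → ∀ t → t ≤ B → P t (f t)
  pick h = proj₁ ∘ clamped , λ t t≤B → subst (λ s → P s (proj₁ (clamped t))) (m≤n⇒m⊓n≡m t≤B) (proj₂ (clamped t))
    where
    clamped : ∀ t → Σ A (P (t ⊓ B))
    clamped t = h (t ⊓ B) (m⊓n≤n t B)

module _ {AP : Set} where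

  -- A guess of a truth value for every subformula occurrence of φ.
  Ann : LTL AP → Set
  Children : LTL AP → Set

  Ann φ = Bool × Children φ

  Children (atom _)  = ⊤
  Children (natom _) = ⊤
  Children (φ ∧ₗ ψ)  = Ann φ × Ann ψ
  Children (φ ∨ₗ ψ)  = Ann φ × Ann ψ
  Children (Xₗ φ)    = Ann φ
  Children (φ Uₗ ψ)  = Ann φ × Ann ψ
  Children (φ Rₗ ψ)  = Ann φ × Ann ψ

  root : ∀ {φ} → Ann φ → Bool
  root = proj₁

  finite-Ann : ∀ φ → Finite (Ann φ)
  finite-Ann (atom _)  = finite-× finite-Bool finite-⊤
  finite-Ann (natom _) = finite-× finite-Bool finite-⊤
  finite-Ann (φ ∧ₗ ψ)  = finite-× finite-Bool (finite-× (finite-Ann φ) (finite-Ann ψ))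
  finite-Ann (φ ∨ₗ ψ)  = finite-× finite-Bool (finite-× (finite-Ann φ) (finite-Ann ψ))
  finite-Ann (Xₗ φ)    = finite-× finite-Bool (finite-Ann φ)
  finite-Ann (φ Uₗ ψ)  = finite-× finite-Bool (finite-× (finite-Ann φ) (finite-Ann ψ))
  finite-Ann (φ Rₗ ψ)  = finite-× finite-Bool (finite-× (finite-Ann φ) (finite-Ann ψ))

  eventualities : LTL AP → ℕ
  eventualities (atom _)  = 0
  eventualities (natom _) = 0
  eventualities (φ ∧ₗ ψ)  = eventualities φ + eventualities ψ
  eventualities (φ ∨ₗ ψ)  = eventualities φ + eventualities ψ
  eventualities (Xₗ φ)    = eventualities φ
  eventualities (φ Uₗ ψ)  = suc (eventualities φ + eventualities ψ)
  eventualities (φ Rₗ ψ)  = eventualities φ + eventualities ψ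

  untils : ∀ φ → Vec (LTL AP × LTL AP) (eventualities φ)
  untils (atom _)  = []
  untils (natom _) = []
  untils (φ ∧ₗ ψ)  = untils φ ++ untils ψ
  untils (φ ∨ₗ ψ)  = untils φ ++ untils ψ
  untils (Xₗ φ)    = untils φ
  untils (φ Uₗ ψ)  = (φ , ψ) ∷ (untils φ ++ untils ψ)
  untils (φ Rₗ ψ)  = untils φ ++ untils ψ

  discharged : ∀ φ → Ann φ → Vec Bool (eventualities φ)
  discharged (atom _)  _           = []
  discharged (natom _) _           = []
  discharged (φ ∧ₗ ψ)  (_ , x , y) = discharged φ x ++ discharged ψ y
  discharged (φ ∨ₗ ψ)  (_ , x , y) = discharged φ x ++ discharged ψ y
  discharged (Xₗ φ)    (_ , x)     = discharged φ x
  discharged (φ Uₗ ψ)  (r , x , y) = (not r ∨ root y) ∷ (discharged φ x ++ discharged ψ y)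
  discharged (φ Rₗ ψ)  (_ , x , y) = discharged φ x ++ discharged ψ y

module _ {AP : Set} (M : Kripke AP) where
  open Kripke M

  Path : Set
  Path = ℕ → State

  infix 4 _^_⊨_ _^_⊨nl[_]_

  _^_⊨_ : Path → ℕ → LTL AP → Set
  π ^ i ⊨ φ = _,_⊨_ M π i φ

  _^_⊨nl[_]_ : Path → ℕ → ℕ → LTL AP → Set
  π ^ i ⊨nl[ k ] φ = _,_⊨nl[_]_ M π i k φ

  ⊨-resp-SameFrom : ∀ φ {π π′ i j} → SameFrom π i π′ j → π ^ i ⊨ φ → π′ ^ j ⊨ φ
  ⊨-resp-SameFrom (atom p)  same = subst (λ s → L s p ≡ true) (SameFrom-head same)
  ⊨-resp-SameFrom (natom p) same = subst (λ s → L s p ≡ false) (SameFrom-head same)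
  ⊨-resp-SameFrom (φ ∧ₗ ψ)  same (s₁ , s₂) = ⊨-resp-SameFrom φ same s₁ , ⊨-resp-SameFrom ψ same s₂
  ⊨-resp-SameFrom (φ ∨ₗ ψ)  same (inj₁ s) = inj₁ (⊨-resp-SameFrom φ same s)
  ⊨-resp-SameFrom (φ ∨ₗ ψ)  same (inj₂ s) = inj₂ (⊨-resp-SameFrom ψ same s)
  ⊨-resp-SameFrom (Xₗ φ)    same = ⊨-resp-SameFrom φ (SameFrom-suc same)
  ⊨-resp-SameFrom (φ Uₗ ψ)  same =
    Until-shift (λ d → ⊨-resp-SameFrom φ (SameFrom-shift same d))
                (λ d → ⊨-resp-SameFrom ψ (SameFrom-shift same d))
  ⊨-resp-SameFrom (φ Rₗ ψ)  same =
    Release-shift (λ d → ⊨-resp-SameFrom φ (SameFrom-shift same d))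
                  (λ d → ⊨-resp-SameFrom ψ (SameFrom-shift same d))

  ⊨nl⇒⊨ : ∀ {k} φ {π i} → π ^ i ⊨nl[ k ] φ → π ^ i ⊨ φ
  ⊨nl⇒⊨ (atom p)  s = s
  ⊨nl⇒⊨ (natom p) s = s
  ⊨nl⇒⊨ (φ ∧ₗ ψ)  (s₁ , s₂) = ⊨nl⇒⊨ φ s₁ , ⊨nl⇒⊨ ψ s₂
  ⊨nl⇒⊨ (φ ∨ₗ ψ)  (inj₁ s) = inj₁ (⊨nl⇒⊨ φ s)
  ⊨nl⇒⊨ (φ ∨ₗ ψ)  (inj₂ s) = inj₂ (⊨nl⇒⊨ ψ s)
  ⊨nl⇒⊨ (Xₗ φ)    (_ , s) = ⊨nl⇒⊨ φ s
  ⊨nl⇒⊨ (φ Uₗ ψ)  (j , i≤j , _ , q , ps) =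
    j , i≤j , ⊨nl⇒⊨ ψ q , λ m i≤m m<j → ⊨nl⇒⊨ φ (ps m i≤m m<j)
  ⊨nl⇒⊨ (φ Rₗ ψ)  (j , i≤j , _ , p , qs) =
    StrongRelease⇒Release (j , i≤j , ⊨nl⇒⊨ φ p , λ m i≤m m≤j → ⊨nl⇒⊨ ψ (qs m i≤m m≤j))

  module _ {ρ : Path} {k l : ℕ} (loop : IsLoop M k l ρ) where

    private
      l≤k : l ≤ k
      l≤k = proj₁ (proj₂ loop)

    loop-SameFrom : SameFrom ρ (suc k) ρ l
    loop-SameFrom = sameFrom (proj₂ (proj₂ (proj₂ loop)))

    Folded : ℕ → Set
    Folded j = ∃ λ j′ → l ≤ j′ × j′ ≤ k × j′ ≤ j × SameFrom ρ j ρ j′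

    fold-into-loop : ∀ j → l ≤ j → Folded j
    fold-into-loop = <-rec (λ j → l ≤ j → Folded j) fold
      where
      fold : ∀ j → (∀ {j₀} → j₀ < j → l ≤ j₀ → Folded j₀) → l ≤ j → Folded j
      fold j rec l≤j with j ≤? k
      ... | yes j≤k = j , l≤j , j≤k , ≤-refl , sameFrom λ _ → refl
      ... | no j≰k with offset (≰⇒> j≰k)
      ...   | d , refl with rec (+-monoˡ-< d (s≤s l≤k)) (m≤m+n l d)
      ...     | j′ , l≤j′ , j′≤k , j′≤l+d , same =
        j′ , l≤j′ , j′≤k , ≤-trans j′≤l+d (<⇒≤ (+-monoˡ-< d (s≤s l≤k))) ,
        SameFrom-trans (SameFrom-shift loop-SameFrom d) same

    until-from-loop-start : ∀ φ ψ → ρ ^ l ⊨ φ Uₗ ψ →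
                            Until (ρ ^_⊨ φ) (λ j → j ≤ k × ρ ^ j ⊨ ψ) l
    until-from-loop-start φ ψ (w , l≤w , q , ps) with fold-into-loop w l≤w
    ... | w′ , l≤w′ , w′≤k , w′≤w , same =
      w′ , l≤w′ , (w′≤k , ⊨-resp-SameFrom ψ same q) ,
      λ m l≤m m<w′ → ps m l≤m (<-≤-trans m<w′ w′≤w)

    release-from-loop-start : ∀ φ ψ → Release (ρ ^_⊨ φ) (λ j → k < j ⊎ ρ ^ j ⊨ ψ) l →
                              ρ ^ l ⊨ φ Rₗ ψ
    release-from-loop-start φ ψ r j l≤j with fold-into-loop j l≤j
    ... | j′ , l≤j′ , j′≤k , j′≤j , same with r j′ l≤j′
    ...   | inj₁ (inj₁ k<j′) = contradiction j′≤k (<⇒≱ k<j′)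
    ...   | inj₁ (inj₂ q) = inj₁ (⊨-resp-SameFrom ψ (SameFrom-sym same) q)
    ...   | inj₂ (m , l≤m , m<j′ , p) = inj₂ (m , l≤m , <-≤-trans m<j′ j′≤j , p)

  unroll-isLoop : ∀ {k l} (0<l : 0 < l) (l≤k : l ≤ k) (σ : Path) → σ (l ∸ 1) ≡ σ k →
                  IsLoop M k l (σ ∘ LassoIndex.idx k l l≤k)
  unroll-isLoop {k} {l} 0<l l≤k σ back =
    0<l , l≤k ,
    trans (cong σ (idx-prefix (≤-trans (m∸n≤m l 1) l≤k))) (trans back (cong σ (sym (idx-prefix ≤-refl)))) ,
    λ m → cong σ (idx-loop m)
    where open LassoIndex k l l≤k

  extend-path : ∀ k (σ : Path) → (∀ m → m < k → T (σ m) (σ (suc m)) ≡ true) →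
                ∃ λ π → IsPath M π × (∀ u → u ≤ k → σ u ≡ π u)
  extend-path k σ walk = π , path , agree
    where
    π : Path
    π zero = σ 0
    π (suc t) with suc t ≤? k
    ... | yes _ = σ (suc t)
    ... | no _  = proj₁ (total (π t))

    agree : ∀ u → u ≤ k → σ u ≡ π u
    agree zero _ = refl
    agree (suc u) u<k with suc u ≤? k
    ... | yes _   = refl
    ... | no u≮k = contradiction u<k u≮k

    path : IsPath M π
    path t with suc t ≤? k
    ... | yes t<k rewrite sym (agree t (<⇒≤ t<k)) = walk t t<k
    ... | no _    = proj₂ (total (π t))

  module EncodingProperties (k : ℕ) (a : Assignment n) where
    open Assignment a
    open Encoding M k a public

    ModelConstraints : Set
    ModelConstraints = I (st 0) ≡ true × (∀ m → m < k → T (st m) (st (suc m)) ≡ true)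

    LoopStepConstraints : ℕ → Set
    LoopStepConstraints m = (lv (suc m) ≡ true → st m ≡ st k)
                          × inLoop (suc m) ≡ (inLoop m ∨ lv (suc m))
                          × (inLoop m ≡ true → lv (suc m) ≡ false)

    LoopConstraints : Set
    LoopConstraints = lv 0 ≡ false × inLoop 0 ≡ false × (∀ m → m < k → LoopStepConstraints m)
                    × loopExists ≡ inLoop k

    stEq-reflects : ∀ s s′ → Reflects (s ≡ s′) (stEq s s′)
    stEq-reflects s s′ with ≡-dec Bool._≟_ s s′
    ... | true  because r = r
    ... | false because r = r

    modelC-reflects : Reflects ModelConstraints modelC
    modelC-reflects = ≡true-reflects _ ×-reflects andUpTo-reflects k (λ _ _ → ≡true-reflects _)

    loopC-reflects : Reflects LoopConstraints loopC
    loopC-reflects =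
      ≡false-reflects _ ×-reflects ≡false-reflects _ ×-reflects
      andUpTo-reflects k (λ _ _ → (≡true-reflects _ →-reflects stEq-reflects _ _) ×-reflects
                                  ⇔ᵇ-reflects _ _ ×-reflects
                                  (≡true-reflects _ →-reflects ≡false-reflects _)) ×-reflects
      ⇔ᵇ-reflects _ _

    encoding-reflects : ∀ ψ → Reflects (ModelConstraints × LoopConstraints × tr ψ 0 ≡ true) (encoding ψ)
    encoding-reflects ψ = modelC-reflects ×-reflects loopC-reflects ×-reflects ≡true-reflects (tr ψ 0)

    model-from-path : ∀ {π} → IsPath M π → Initialised M π → (∀ u → u ≤ k → st u ≡ π u) →
                      ModelConstraints
    model-from-path {π} path init agree =
      subst (λ s → I s ≡ true) (sym (agree 0 z≤n)) init ,
      λ m m<k → subst₂ (λ s s′ → T s s′ ≡ true) (sym (agree m (<⇒≤ m<k))) (sym (agree (suc m) m<k))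
                       (path m)

    loopOr-reflects : ∀ h → Reflects (∃ λ m → m < k × lv (suc m) ≡ true × h (suc m) ≡ true) (loopOr h)
    loopOr-reflects h = orUpTo-reflects k (λ _ _ → ≡true-reflects _ ×-reflects ≡true-reflects _)

    loopOr-single : ∀ {l} → 0 < l → l ≤ k → lv l ≡ true →
                    (∀ m → m < k → lv (suc m) ≡ true → suc m ≡ l) → ∀ h → loopOr h ≡ h l
    loopOr-single {suc m₀} _ l≤k lv-l unique h =
      det (loopOr-reflects h) (map-reflects at-l from-l (≡true-reflects _))
      where
      at-l : h (suc m₀) ≡ true → ∃ λ m → m < k × lv (suc m) ≡ true × h (suc m) ≡ true
      at-l hl = m₀ , l≤k , lv-l , hl
      from-l : (∃ λ m → m < k × lv (suc m) ≡ true × h (suc m) ≡ true) → h (suc m₀) ≡ true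
      from-l (m , m<k , lvm , hm) = subst (λ j → h j ≡ true) (unique m m<k lvm) hm

    loopOr-none : (∀ m → m < k → lv (suc m) ≡ false) → ∀ h → loopOr h ≡ false
    loopOr-none none h =
      det (loopOr-reflects h) (ofⁿ λ (m , m<k , lvm , _) → contradiction (trans (sym lvm) (none m m<k)) λ ())

    tr-X-< : ∀ φ {i} → i < k → tr (Xₗ φ) i ≡ tr φ (suc i)
    tr-X-< φ {i} i<k rewrite reflected⇒true (<ᵇ-reflects-< i k) i<k = refl

    tr-X-k : ∀ φ → tr (Xₗ φ) k ≡ loopOr (tr φ)
    tr-X-k φ rewrite unreflected⇒false (<ᵇ-reflects-< k k) (<-irrefl refl) = refl

    atom-reflects : ∀ {ρ : Path} {i} p → st i ≡ ρ i → Reflects (ρ ^ i ⊨ atom p) (tr (atom p) i)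
    atom-reflects p eq rewrite eq = ≡true-reflects _

    natom-reflects : ∀ {ρ : Path} {i} p → st i ≡ ρ i → Reflects (ρ ^ i ⊨ natom p) (tr (natom p) i)
    natom-reflects p eq rewrite eq = ≡false-reflects _

    module _ (f g : ℕ → Bool) {S : ℕ → Set} where

      UntilStep : Set
      UntilStep = ∀ {m b} → m ≤ k → Reflects (S (suc m)) b → Reflects (S m) (g m ∨ (f m ∧ b))

      ReleaseStep : Set
      ReleaseStep = ∀ {m b} → m ≤ k → Reflects (S (suc m)) b → Reflects (S m) (g m ∧ (f m ∨ b))

      trU-reflects : UntilStep → Reflects (S (suc k)) (loopOr (λ j → auxU f g (k ∸ j) j)) →
                     ∀ r {i} → r + i ≡ k → Reflects (S i) (trU f g r i)
      trU-reflects step tail zero refl = step ≤-refl tail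
      trU-reflects step tail (suc r) {i} eq =
        step (subst (i ≤_) eq (m≤n+m i (suc r))) (trU-reflects step tail r (trans (+-suc r i) eq))

      trR-reflects : ReleaseStep → Reflects (S (suc k)) (loopOr (λ j → auxR f g (k ∸ j) j)) →
                     ∀ r {i} → r + i ≡ k → Reflects (S i) (trR f g r i)
      trR-reflects step tail zero refl = step ≤-refl tail
      trR-reflects step tail (suc r) {i} eq =
        step (subst (i ≤_) eq (m≤n+m i (suc r))) (trR-reflects step tail r (trans (+-suc r i) eq))

      auxU-reflects : UntilStep → Reflects (S (suc k)) false →
                      ∀ r {j} → r + j ≡ k → Reflects (S j) (auxU f g r j)
      auxU-reflects step beyond zero refl =
        subst (Reflects (S k)) (trans (cong (g k ∨_) (∧-zeroʳ (f k))) (∨-identityʳ (g k))) (step ≤-refl beyond)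
      auxU-reflects step beyond (suc r) {j} eq =
        step (subst (j ≤_) eq (m≤n+m j (suc r))) (auxU-reflects step beyond r (trans (+-suc r j) eq))

      auxR-reflects : ReleaseStep → Reflects (S (suc k)) true →
                      ∀ r {j} → r + j ≡ k → Reflects (S j) (auxR f g r j)
      auxR-reflects step beyond zero refl =
        subst (Reflects (S k)) (trans (cong (g k ∧_) (∨-zeroʳ (f k))) (∧-identityʳ (g k))) (step ≤-refl beyond)
      auxR-reflects step beyond (suc r) {j} eq =
        step (subst (j ≤_) eq (m≤n+m j (suc r))) (auxR-reflects step beyond r (trans (+-suc r j) eq))

    module LassoCorrect {ρ : Path} {l : ℕ} (agree : ∀ u → u ≤ k → st u ≡ ρ u) (loop : IsLoop M k l ρ)
                        (loopOr-l : ∀ h → loopOr h ≡ h l) where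

      private
        l≤k : l ≤ k
        l≤k = proj₁ (proj₂ loop)

        to-loop-start : ∀ φ → ρ ^ suc k ⊨ φ → ρ ^ l ⊨ φ
        to-loop-start φ = ⊨-resp-SameFrom φ (loop-SameFrom loop)

        from-loop-start : ∀ φ → ρ ^ l ⊨ φ → ρ ^ suc k ⊨ φ
        from-loop-start φ = ⊨-resp-SameFrom φ (SameFrom-sym (loop-SameFrom loop))

      tr-reflects : ∀ φ {i} → i ≤ k → Reflects (ρ ^ i ⊨ φ) (tr φ i)
      tr-reflects (atom p)  {i} i≤k = atom-reflects {ρ} p (agree i i≤k)
      tr-reflects (natom p) {i} i≤k = natom-reflects {ρ} p (agree i i≤k)
      tr-reflects (φ ∧ₗ ψ) i≤k = tr-reflects φ i≤k ×-reflects tr-reflects ψ i≤k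
      tr-reflects (φ ∨ₗ ψ) i≤k = tr-reflects φ i≤k ⊎-reflects tr-reflects ψ i≤k
      tr-reflects (Xₗ φ) i≤k with m≤n⇒m<n∨m≡n i≤k
      ... | inj₁ i<k  rewrite tr-X-< φ i<k = tr-reflects φ i<k
      ... | inj₂ refl rewrite tr-X-k φ | loopOr-l (tr φ) =
        map-reflects (from-loop-start φ) (to-loop-start φ) (tr-reflects φ l≤k)
      tr-reflects (φ Uₗ ψ) {i} i≤k =
        trU-reflects (tr φ) (tr ψ) (λ m≤k → until-unfold (tr-reflects ψ m≤k) (tr-reflects φ m≤k))
                     tail (k ∸ i) (m∸n+n≡m i≤k)
        where
        tail : Reflects (ρ ^ suc k ⊨ φ Uₗ ψ) (loopOr (λ j → auxU (tr φ) (tr ψ) (k ∸ j) j))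
        tail rewrite loopOr-l (λ j → auxU (tr φ) (tr ψ) (k ∸ j) j) =
          map-reflects (from-loop-start (φ Uₗ ψ) ∘ Until-map id proj₂)
                       (until-from-loop-start loop φ ψ ∘ to-loop-start (φ Uₗ ψ))
                       (auxU-reflects (tr φ) (tr ψ)
                          (λ m≤k → untilWithin-unfold m≤k (tr-reflects ψ m≤k) (tr-reflects φ m≤k))
                          (ofⁿ untilWithin-beyond) (k ∸ l) (m∸n+n≡m l≤k))
      tr-reflects (φ Rₗ ψ) {i} i≤k =
        trR-reflects (tr φ) (tr ψ) (λ m≤k → release-unfold (tr-reflects ψ m≤k) (tr-reflects φ m≤k))
                     tail (k ∸ i) (m∸n+n≡m i≤k)
        where
        tail : Reflects (ρ ^ suc k ⊨ φ Rₗ ψ) (loopOr (λ j → auxR (tr φ) (tr ψ) (k ∸ j) j))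
        tail rewrite loopOr-l (λ j → auxR (tr φ) (tr ψ) (k ∸ j) j) =
          map-reflects (from-loop-start (φ Rₗ ψ) ∘ release-from-loop-start loop φ ψ)
                       (Release-map id inj₂ ∘ to-loop-start (φ Rₗ ψ))
                       (auxR-reflects (tr φ) (tr ψ)
                          (λ m≤k → releaseWithin-unfold m≤k (tr-reflects ψ m≤k) (tr-reflects φ m≤k))
                          (ofʸ releaseWithin-beyond) (k ∸ l) (m∸n+n≡m l≤k))

    module NoLoopCorrect {ρ : Path} (agree : ∀ u → u ≤ k → st u ≡ ρ u)
                         (no-loop : ∀ h → loopOr h ≡ false) where

      tr-reflects-nl : ∀ φ {i} → i ≤ k → Reflects (ρ ^ i ⊨nl[ k ] φ) (tr φ i)
      tr-reflects-nl (atom p)  {i} i≤k = atom-reflects {ρ} p (agree i i≤k)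
      tr-reflects-nl (natom p) {i} i≤k = natom-reflects {ρ} p (agree i i≤k)
      tr-reflects-nl (φ ∧ₗ ψ) i≤k = tr-reflects-nl φ i≤k ×-reflects tr-reflects-nl ψ i≤k
      tr-reflects-nl (φ ∨ₗ ψ) i≤k = tr-reflects-nl φ i≤k ⊎-reflects tr-reflects-nl ψ i≤k
      tr-reflects-nl (Xₗ φ) i≤k with m≤n⇒m<n∨m≡n i≤k
      ... | inj₁ i<k  rewrite tr-X-< φ i<k = map-reflects (i<k ,_) proj₂ (tr-reflects-nl φ i<k)
      ... | inj₂ refl rewrite tr-X-k φ | no-loop (tr φ) = ofⁿ λ (k<k , _) → <-irrefl refl k<k
      tr-reflects-nl (φ Uₗ ψ) {i} i≤k =
        map-reflects (λ (j , i≤j , (j≤k , q) , ps) → j , i≤j , j≤k , q , ps)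
                     (λ (j , i≤j , j≤k , q , ps) → j , i≤j , (j≤k , q) , ps)
                     (trU-reflects (tr φ) (tr ψ)
                        (λ m≤k → untilWithin-unfold m≤k (tr-reflects-nl ψ m≤k) (tr-reflects-nl φ m≤k))
                        tail (k ∸ i) (m∸n+n≡m i≤k))
        where
        tail : Reflects (UntilWithin k (ρ ^_⊨nl[ k ] φ) (ρ ^_⊨nl[ k ] ψ) (suc k))
                        (loopOr (λ j → auxU (tr φ) (tr ψ) (k ∸ j) j))
        tail rewrite no-loop (λ j → auxU (tr φ) (tr ψ) (k ∸ j) j) = ofⁿ untilWithin-beyond
      tr-reflects-nl (φ Rₗ ψ) {i} i≤k =
        map-reflects (λ (j , i≤j , (j≤k , p) , qs) → j , i≤j , j≤k , p , qs)
                     (λ (j , i≤j , j≤k , p , qs) → j , i≤j , (j≤k , p) , qs)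
                     (trR-reflects (tr φ) (tr ψ)
                        (λ m≤k → strongReleaseWithin-unfold m≤k (tr-reflects-nl ψ m≤k) (tr-reflects-nl φ m≤k))
                        tail (k ∸ i) (m∸n+n≡m i≤k))
        where
        tail : Reflects (StrongReleaseWithin k (ρ ^_⊨nl[ k ] φ) (ρ ^_⊨nl[ k ] ψ) (suc k))
                        (loopOr (λ j → auxR (tr φ) (tr ψ) (k ∸ j) j))
        tail rewrite no-loop (λ j → auxR (tr φ) (tr ψ) (k ∸ j) j) = ofⁿ strongReleaseWithin-beyond

    module _ (model : ModelConstraints) (loopCs : LoopConstraints) where

      private
        steps : ∀ m → m < k → LoopStepConstraints m
        steps = proj₁ (proj₂ (proj₂ loopCs))

        walk : ∀ m → m < k → T (st m) (st (suc m)) ≡ true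
        walk = proj₂ model

      inLoop-after : ∀ {m₁} m₂ → lv (suc m₁) ≡ true → m₁ < m₂ → m₂ ≤ k → inLoop m₂ ≡ true
      inLoop-after {m₁} (suc m₂) lv₁ m₁<1+m₂ m₂<k with m<1+n⇒m<n∨m≡n m₁<1+m₂
      ... | inj₁ m₁<m₂ =
        trans (proj₁ (proj₂ (steps m₂ m₂<k)))
              (cong (_∨ lv (suc m₂)) (inLoop-after m₂ lv₁ m₁<m₂ (<⇒≤ m₂<k)))
      ... | inj₂ refl =
        trans (proj₁ (proj₂ (steps m₁ m₂<k))) (trans (cong (inLoop m₁ ∨_) lv₁) (∨-zeroʳ _))

      no-loop-start-after : ∀ {m₁ m₂} → m₁ < m₂ → m₂ < k →
                            lv (suc m₁) ≡ true → lv (suc m₂) ≡ false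
      no-loop-start-after {m₂ = m₂} m₁<m₂ m₂<k lv₁ =
        proj₂ (proj₂ (steps m₂ m₂<k)) (inLoop-after m₂ lv₁ m₁<m₂ (<⇒≤ m₂<k))

      loop-start-unique : ∀ {m₁ m₂} → m₁ < k → m₂ < k →
                          lv (suc m₁) ≡ true → lv (suc m₂) ≡ true → m₁ ≡ m₂
      loop-start-unique {m₁} {m₂} m₁<k m₂<k lv₁ lv₂ with <-cmp m₁ m₂
      ... | tri< m₁<m₂ _ _ = contradiction (trans (sym lv₂) (no-loop-start-after m₁<m₂ m₂<k lv₁)) λ ()
      ... | tri≈ _ eq _    = eq
      ... | tri> _ _ m₂<m₁ = contradiction (trans (sym lv₁) (no-loop-start-after m₂<m₁ m₁<k lv₂)) λ ()

      path-from-assignment : ∀ ψ → tr ψ 0 ≡ true → ∃ λ π → IsPath M π × Initialised M π × π ^ 0 ⊨ ψ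
      path-from-assignment ψ tr₀ with anyUpTo? (λ m → lv (suc m) Bool.≟ true) k
      ... | yes (m , m<k , lv-l) =
        st ∘ idx , unroll-step (λ s s′ → T s s′ ≡ true) st walk back , proj₁ model ,
        true⇒reflected (LassoCorrect.tr-reflects agree loop loopOr-l ψ z≤n) tr₀
        where
        open LassoIndex k (suc m) m<k
        st-m≡st-k : st m ≡ st k
        st-m≡st-k = proj₁ (steps m m<k) lv-l
        back : T (st k) (st (suc m)) ≡ true
        back = subst (λ s → T s (st (suc m)) ≡ true) st-m≡st-k (walk m m<k)
        agree : ∀ u → u ≤ k → st u ≡ st (idx u)
        agree u u≤k = cong st (sym (idx-prefix u≤k))
        loop : IsLoop M k (suc m) (st ∘ idx)
        loop = unroll-isLoop (s≤s z≤n) m<k st st-m≡st-k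
        loopOr-l : ∀ h → loopOr h ≡ h (suc m)
        loopOr-l = loopOr-single (s≤s z≤n) m<k lv-l
                     λ m′ m′<k lv′ → cong suc (loop-start-unique m′<k m<k lv′ lv-l)
      ... | no no-start with extend-path k st walk
      ...   | π , path , agree =
        π , path , subst (λ s → I s ≡ true) (agree 0 z≤n) (proj₁ model) ,
        ⊨nl⇒⊨ ψ (true⇒reflected (NoLoopCorrect.tr-reflects-nl agree (loopOr-none none) ψ z≤n) tr₀)
        where
        none : ∀ m → m < k → lv (suc m) ≡ false
        none m m<k = unreflected⇒false (≡true-reflects _) λ lvm → no-start (m , m<k , lvm)

  soundness : ∀ ψ k → Satisfiable M ψ k → ∃ λ π → IsPath M π × Initialised M π × π ^ 0 ⊨ ψ
  soundness ψ k (a , enc) =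
    let model , loopCs , tr₀ = true⇒reflected (encoding-reflects ψ) enc
    in path-from-assignment model loopCs ψ tr₀
    where open EncodingProperties k a

  loopAssignment : Path → ℕ → Assignment n
  loopAssignment σ l = record { st = σ ; lv = _≡ᵇ l ; inLoop = l ≤ᵇ_ ; loopExists = true }

  noLoopAssignment : Path → Assignment n
  noLoopAssignment σ = record { st = σ ; lv = λ _ → false ; inLoop = λ _ → false ; loopExists = false }

  module _ {π σ : Path} {k : ℕ} (path : IsPath M π) (init : Initialised M π)
           (agree : ∀ u → u ≤ k → σ u ≡ π u) where

    lasso-encoded : ∀ {l} ψ → IsLoop M k l π → π ^ 0 ⊨ ψ →
                    Encoding.encoding M k (loopAssignment σ l) ψ ≡ true
    lasso-encoded {l@(suc _)} ψ loop@(_ , l≤k , π[l-1]≡π[k] , _) s =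
      reflected⇒true (encoding-reflects ψ) (model-from-path path init agree , loopCs , tr₀)
      where
      open EncodingProperties k (loopAssignment σ l)
      step : ∀ m → m < k → LoopStepConstraints m
      step m m<k = back , inLoop-step , not-start
        where
        not-start : (l ≤ᵇ m) ≡ true → (suc m ≡ᵇ l) ≡ false
        not-start l≤m = unreflected⇒false (≡ᵇ-reflects-≡ (suc m) l)
                          λ eq → <-irrefl (sym eq) (s≤s (true⇒reflected (≤ᵇ-reflects-≤ l m) l≤m))
        back : (suc m ≡ᵇ l) ≡ true → σ m ≡ σ k
        back eq with true⇒reflected (≡ᵇ-reflects-≡ (suc m) l) eq
        ... | refl = trans (agree m (<⇒≤ m<k)) (trans π[l-1]≡π[k] (sym (agree k ≤-refl)))
        split : l ≤ suc m → l ≤ m ⊎ suc m ≡ l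
        split l≤1+m with m≤n⇒m<n∨m≡n l≤1+m
        ... | inj₁ l<1+m = inj₁ (≤-pred l<1+m)
        ... | inj₂ eq    = inj₂ (sym eq)
        join : l ≤ m ⊎ suc m ≡ l → l ≤ suc m
        join (inj₁ l≤m) = m≤n⇒m≤1+n l≤m
        join (inj₂ eq)  = ≤-reflexive (sym eq)
        inLoop-step : (l ≤ᵇ suc m) ≡ ((l ≤ᵇ m) ∨ (suc m ≡ᵇ l))
        inLoop-step = det (≤ᵇ-reflects-≤ l (suc m))
                          (map-reflects join split (≤ᵇ-reflects-≤ l m ⊎-reflects ≡ᵇ-reflects-≡ (suc m) l))
      loopCs : LoopConstraints
      loopCs = refl , refl , step , sym (reflected⇒true (≤ᵇ-reflects-≤ l k) l≤k)
      tr₀ : tr ψ 0 ≡ true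
      tr₀ = reflected⇒true (LassoCorrect.tr-reflects agree loop loopOr-l ψ z≤n) s
        where
        loopOr-l : ∀ h → loopOr h ≡ h l
        loopOr-l = loopOr-single (s≤s z≤n) l≤k (reflected⇒true (≡ᵇ-reflects-≡ l l) refl)
                                 λ m _ → true⇒reflected (≡ᵇ-reflects-≡ (suc m) l)

    no-loop-encoded : ∀ ψ → π ^ 0 ⊨nl[ k ] ψ → Encoding.encoding M k (noLoopAssignment σ) ψ ≡ true
    no-loop-encoded ψ s = reflected⇒true (encoding-reflects ψ) (model-from-path path init agree , loopCs , tr₀)
      where
      open EncodingProperties k (noLoopAssignment σ)
      loopCs : LoopConstraints
      loopCs = refl , refl , (λ _ _ → (λ ()) , refl , λ ()) , refl
      tr₀ : tr ψ 0 ≡ true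
      tr₀ = reflected⇒true (NoLoopCorrect.tr-reflects-nl agree (loopOr-none λ _ _ → refl) ψ z≤n) s

  bounded-completeness : ∀ ψ k π → IsPath M π → Initialised M π → _⊨[_]_ M π k ψ → Satisfiable M ψ k
  bounded-completeness ψ k π path init (inj₁ (l , loop , s)) =
    loopAssignment π l , lasso-encoded path init (λ _ _ → refl) ψ loop s
  bounded-completeness ψ k π path init (inj₂ s) =
    noLoopAssignment π , no-loop-encoded path init (λ _ _ → refl) ψ s

  Consistent : ∀ φ → State → Ann φ → Ann φ → Set
  Consistent (atom p)  s (r , _) _ = r ≡ L s p
  Consistent (natom p) s (r , _) _ = r ≡ not (L s p)
  Consistent (φ ∧ₗ ψ)  s (r , x , y) (_ , x′ , y′) =
    r ≡ (root x ∧ root y) × Consistent φ s x x′ × Consistent ψ s y y′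
  Consistent (φ ∨ₗ ψ)  s (r , x , y) (_ , x′ , y′) =
    r ≡ (root x ∨ root y) × Consistent φ s x x′ × Consistent ψ s y y′
  Consistent (Xₗ φ)    s (r , x) (_ , x′) =
    r ≡ root x′ × Consistent φ s x x′
  Consistent (φ Uₗ ψ)  s (r , x , y) (r′ , x′ , y′) =
    r ≡ (root y ∨ (root x ∧ r′)) × Consistent φ s x x′ × Consistent ψ s y y′
  Consistent (φ Rₗ ψ)  s (r , x , y) (r′ , x′ , y′) =
    r ≡ (root y ∧ (root x ∨ r′)) × Consistent φ s x x′ × Consistent ψ s y y′

  fair-annotation-sound : ∀ φ {ρ : Path} {X : ℕ → Ann φ} → (∀ t → Consistent φ (ρ t) (X t) (X (suc t))) →
                           Fair (discharged φ ∘ X) → ∀ t → root (X t) ≡ true → ρ ^ t ⊨ φ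
  fair-annotation-sound (atom p)  cons _ t r = trans (sym (cons t)) r
  fair-annotation-sound (natom p) cons _ t r = true⇒reflected (≡false-reflects _) (trans (sym (cons t)) r)
  fair-annotation-sound (φ ∧ₗ ψ) {X = X} cons X-fair t r
    with true⇒reflected (≡true-reflects _ ×-reflects ≡true-reflects _) (trans (sym (proj₁ (cons t))) r)
  ... | x , y = fair-annotation-sound φ (proj₁ ∘ proj₂ ∘ cons) (proj₁ (Fair-++ X-fair)) t x ,
                fair-annotation-sound ψ (proj₂ ∘ proj₂ ∘ cons) (proj₂ (Fair-++ X-fair)) t y
  fair-annotation-sound (φ ∨ₗ ψ) {X = X} cons X-fair t r
    with true⇒reflected (≡true-reflects _ ⊎-reflects ≡true-reflects _) (trans (sym (proj₁ (cons t))) r)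
  ... | inj₁ x = inj₁ (fair-annotation-sound φ (proj₁ ∘ proj₂ ∘ cons) (proj₁ (Fair-++ X-fair)) t x)
  ... | inj₂ y = inj₂ (fair-annotation-sound ψ (proj₂ ∘ proj₂ ∘ cons) (proj₂ (Fair-++ X-fair)) t y)
  fair-annotation-sound (Xₗ φ) cons X-fair t r =
    fair-annotation-sound φ (proj₂ ∘ cons) X-fair (suc t) (trans (sym (proj₁ (cons t))) r)
  fair-annotation-sound (φ Uₗ ψ) {X = X} cons X-fair t r with Fair-∷ X-fair
  ... | discharged-often , children-fair with discharged-often t
  ...   | w , t≤w , discharge =
    Until-map (fair-annotation-sound φ (proj₁ ∘ proj₂ ∘ cons) (proj₁ (Fair-++ children-fair)) _)
              (fair-annotation-sound ψ (proj₂ ∘ proj₂ ∘ cons) (proj₂ (Fair-++ children-fair)) _)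
              (until-walk (proj₁ ∘ cons) discharge (w ∸ t) (m∸n+n≡m t≤w) r)
  fair-annotation-sound (φ Rₗ ψ) {X = X} cons X-fair t r =
    Release-map (fair-annotation-sound φ (proj₁ ∘ proj₂ ∘ cons) (proj₁ (Fair-++ X-fair)) _)
                (fair-annotation-sound ψ (proj₂ ∘ proj₂ ∘ cons) (proj₂ (Fair-++ X-fair)) _)
                (release-walk (proj₁ ∘ cons) r)

  module _ (π : Path) where

    Correct : ∀ φ → ℕ → Ann φ → Set
    CorrectChildren : ∀ φ → ℕ → Children φ → Set

    Correct φ t (r , xs) = Reflects (π ^ t ⊨ φ) r × CorrectChildren φ t xs

    CorrectChildren (atom _)  _ _       = ⊤
    CorrectChildren (natom _) _ _       = ⊤
    CorrectChildren (φ ∧ₗ ψ)  t (x , y) = Correct φ t x × Correct ψ t y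
    CorrectChildren (φ ∨ₗ ψ)  t (x , y) = Correct φ t x × Correct ψ t y
    CorrectChildren (Xₗ φ)    t x       = Correct φ t x
    CorrectChildren (φ Uₗ ψ)  t (x , y) = Correct φ t x × Correct ψ t y
    CorrectChildren (φ Rₗ ψ)  t (x , y) = Correct φ t x × Correct ψ t y

    correct-exists : ∀ φ t → ¬ ¬ Σ (Ann φ) (Correct φ t)
    correct-children-exist : ∀ φ t → ¬ ¬ Σ (Children φ) (CorrectChildren φ t)

    correct-exists φ t = do
      d ← ¬¬-excluded-middle
      xs , ok ← correct-children-exist φ t
      return ((does d , xs) , proof d , ok)

    correct-children-exist φ t = children φ
      where
      both : ∀ φ ψ → ¬ ¬ Σ (Ann φ × Ann ψ) λ (x , y) → Correct φ t x × Correct ψ t y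
      both φ ψ = do
        x , cx ← correct-exists φ t
        y , cy ← correct-exists ψ t
        return ((x , y) , cx , cy)
      children : ∀ φ → ¬ ¬ Σ (Children φ) (CorrectChildren φ t)
      children (atom _)  = return (tt , tt)
      children (natom _) = return (tt , tt)
      children (φ ∧ₗ ψ)  = both φ ψ
      children (φ ∨ₗ ψ)  = both φ ψ
      children (Xₗ φ)    = correct-exists φ t
      children (φ Uₗ ψ)  = both φ ψ
      children (φ Rₗ ψ)  = both φ ψ

    correct⇒consistent : ∀ φ {t x x′} → Correct φ t x → Correct φ (suc t) x′ →
                         Consistent φ (π t) x x′
    correct⇒consistent (atom p)  (r , _) _ = det r (≡true-reflects _)
    correct⇒consistent (natom p) (r , _) _ = det r (≡false-reflects _)
    correct⇒consistent (φ ∧ₗ ψ) (r , cx , cy) (_ , cx′ , cy′) =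
      det r (proj₁ cx ×-reflects proj₁ cy) , correct⇒consistent φ cx cx′ , correct⇒consistent ψ cy cy′
    correct⇒consistent (φ ∨ₗ ψ) (r , cx , cy) (_ , cx′ , cy′) =
      det r (proj₁ cx ⊎-reflects proj₁ cy) , correct⇒consistent φ cx cx′ , correct⇒consistent ψ cy cy′
    correct⇒consistent (Xₗ φ) (r , cx) (_ , cx′) = det r (proj₁ cx′) , correct⇒consistent φ cx cx′
    correct⇒consistent (φ Uₗ ψ) (r , cx , cy) (r′ , cx′ , cy′) =
      det r (until-unfold (proj₁ cy) (proj₁ cx) r′) ,
      correct⇒consistent φ cx cx′ , correct⇒consistent ψ cy cy′
    correct⇒consistent (φ Rₗ ψ) (r , cx , cy) (r′ , cx′ , cy′) =
      det r (release-unfold (proj₁ cy) (proj₁ cx) r′) ,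
      correct⇒consistent φ cx cx′ , correct⇒consistent ψ cy cy′

    Obligation : LTL AP × LTL AP → ℕ → Set
    Obligation (φ , ψ) t = π ^ t ⊨ φ Uₗ ψ → π ^ t ⊨ ψ

    discharged-reflects : ∀ φ {t x} → Correct φ t x →
                          Pointwise (λ u b → Reflects (Obligation u t) b) (untils φ) (discharged φ x)
    discharged-reflects (atom _)  _ = []
    discharged-reflects (natom _) _ = []
    discharged-reflects (φ ∧ₗ ψ)  (_ , cx , cy) = ++⁺ (discharged-reflects φ cx) (discharged-reflects ψ cy)
    discharged-reflects (φ ∨ₗ ψ)  (_ , cx , cy) = ++⁺ (discharged-reflects φ cx) (discharged-reflects ψ cy)
    discharged-reflects (Xₗ φ)    (_ , cx)      = discharged-reflects φ cx
    discharged-reflects (φ Uₗ ψ)  (r , cx , cy) =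
      (r →-reflects proj₁ cy) ∷ ++⁺ (discharged-reflects φ cx) (discharged-reflects ψ cy)
    discharged-reflects (φ Rₗ ψ)  (_ , cx , cy) = ++⁺ (discharged-reflects φ cx) (discharged-reflects ψ cy)

    eventually-discharged : ∀ u t → ¬ ¬ ∃ λ w → t ≤ w × Obligation u w
    eventually-discharged (φ , ψ) t = ¬¬-map discharge ¬¬-excluded-middle
      where
      discharge : Dec (π ^ t ⊨ φ Uₗ ψ) → ∃ λ w → t ≤ w × Obligation (φ , ψ) w
      discharge (yes (w , t≤w , q , _)) = w , t≤w , λ _ → q
      discharge (no ¬u) = t , ≤-refl , λ u → contradiction u ¬u

  module _ (ψ : LTL AP) where

    Node : Set
    Node = State × Ann ψ

    Step : Node → Node → Set
    Step (s , x) (s′ , x′) = T s s′ ≡ true × Consistent ψ s x x′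

    bit : Fin (eventualities ψ) → Node → Bool
    bit ι (_ , x) = Vec.lookup (discharged ψ x) ι

    -- The accumulator collects the eventualities discharged so far along the loop, so that
    -- removing cycles from the loop cannot lose a discharge.
    AccNode : Set
    AccNode = Node × Vec Bool (eventualities ψ)

    AccStep : AccNode → AccNode → Set
    AccStep (ν , acc) (ν′ , acc′) = Step ν ν′ × acc′ ≡ Vec.zipWith _∨_ acc (discharged ψ (proj₂ ν′))

    finite-Node : Finite Node
    finite-Node = finite-× (finite-Vec finite-Bool n) (finite-Ann ψ)

    finite-AccNode : Finite AccNode
    finite-AccNode = finite-× finite-Node (finite-Vec finite-Bool (eventualities ψ))

    -- After removing cycles the prefix has at most |Node| and the loop at most |AccNode| steps.
    bound : ℕ
    bound = suc (size finite-AccNode + suc (size finite-Node))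

    accumulator-sound : ∀ {e} (z : ℕ → AccNode) → proj₂ (z 0) ≡ discharged ψ (proj₂ (proj₁ (z 0))) →
                        Walk AccStep z e → ∀ ι → Vec.lookup (proj₂ (z e)) ι ≡ true →
                        ∃ λ d → d ≤ e × bit ι (proj₁ (z d)) ≡ true
    accumulator-sound {e} z start walk ι acc-e =
      true⇒reflected (accumulated-reflects discharges e ι)
                     (trans (cong (λ acc → Vec.lookup acc ι) (sym (trace e ≤-refl))) acc-e)
      where
      discharges : ℕ → Vec Bool (eventualities ψ)
      discharges = discharged ψ ∘ proj₂ ∘ proj₁ ∘ z
      trace : ∀ d → d ≤ e → proj₂ (z d) ≡ accumulated discharges d
      trace = accumulated-unique (proj₂ ∘ z) discharges start (λ d d<e → proj₂ (walk d d<e))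

    record Segment : Set where
      field
        τ : ℕ → Node
        i j : ℕ
        i<j : i < j
        walk : Walk Step τ j
        repeat : τ i ≡ τ j
        initial : I (proj₁ (τ 0)) ≡ true
        accepting : root (proj₂ (τ 0)) ≡ true
        discharges : ∀ ι → ∃ λ t → i < t × t ≤ j × bit ι (τ t) ≡ true

    record AnnotatedLasso : Set where
      field
        k l : ℕ
        k<bound : k < bound
        α : ℕ → Node
        0<l : 0 < l
        l≤k : l ≤ k
        walk : Walk Step α k
        back : Step (α k) (α l)
        repeat : proj₁ (α (l ∸ 1)) ≡ proj₁ (α k)
        initial : I (proj₁ (α 0)) ≡ true
        accepting : root (proj₂ (α 0)) ≡ true
        discharges : ∀ ι → ∃ λ u → l ≤ u × u ≤ k × bit ι (α u) ≡ true

    module SegmentShortening (seg : Segment) where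
      open Segment seg

      e : ℕ
      e = j ∸ suc i

      e+i+1≡j : suc (e + i) ≡ j
      e+i+1≡j = trans (sym (+-suc e i)) (m∸n+n≡m i<j)

      loop-discharges : ℕ → Vec Bool (eventualities ψ)
      loop-discharges d = discharged ψ (proj₂ (τ (suc (d + i))))

      acc-node : ℕ → AccNode
      acc-node d = τ (suc (d + i)) , accumulated loop-discharges d

      loop-walk : Walk AccStep acc-node e
      loop-walk d d<e = walk (suc (d + i)) (subst₂ _<_ (+-suc d i) (m∸n+n≡m i<j) (+-monoˡ-< (suc i) d<e)) , refl

      loop-covers : ∀ ι → Vec.lookup (accumulated loop-discharges e) ι ≡ true
      loop-covers ι with discharges ι
      ... | t , i<t , t≤j , bit-t with offsetʳ i<t
      ...   | d , refl = reflected⇒true (accumulated-reflects loop-discharges e ι)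
                           (d , +-cancelʳ-≤ (suc i) d e (subst (d + suc i ≤_) (sym (m∸n+n≡m i<j)) t≤j) ,
                            subst (λ t → bit ι (τ t) ≡ true) (+-suc d i) bit-t)

      annotated-lasso : AnnotatedLasso
      annotated-lasso with shorten Step finite-Node i (λ x x<i → walk x (<-trans x<i i<j))
               | shorten AccStep finite-AccNode e loop-walk
      ... | r , u , r≤N , u₀ , uᵣ , walk-u | e′ , z , e′≤A , z₀ , zₑ , walk-z = record
        { k = e′ + suc r ; l = suc r ; k<bound = s≤s (+-mono-≤ e′≤A (s≤s r≤N))
        ; α = α ; 0<l = s≤s z≤n ; l≤k = m≤n+m (suc r) e′
        ; walk = Walk-splice Step walk-u bridge (λ d d<e′ → proj₁ (walk-z d d<e′))
        ; back = subst₂ Step α-k (trans (sym ν₀) (sym (splice-> r u ν 0)))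
                        (subst (λ ν₀ → Step ν₀ (τ (suc i))) repeat (walk i i<j))
        ; repeat = cong proj₁ (trans (splice-≤ r u ν ≤-refl) (trans uᵣ (trans repeat α-k)))
        ; initial = subst (λ ν₀ → I (proj₁ ν₀) ≡ true) (sym α-0) initial
        ; accepting = subst (λ ν₀ → root (proj₂ ν₀) ≡ true) (sym α-0) accepting
        ; discharges = loop-fair
        }
        where
        ν : ℕ → Node
        ν = proj₁ ∘ z
        α : ℕ → Node
        α = splice r u ν
        ν₀ : ν 0 ≡ τ (suc i)
        ν₀ = cong proj₁ z₀
        α-0 : α 0 ≡ τ 0
        α-0 = trans (splice-≤ r u ν z≤n) u₀
        α-k : τ j ≡ α (e′ + suc r)
        α-k = trans (sym (cong τ e+i+1≡j)) (trans (sym (cong proj₁ zₑ)) (sym (splice-> r u ν e′)))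
        bridge : Step (u r) (ν 0)
        bridge = subst₂ Step (sym uᵣ) (sym ν₀) (walk i i<j)
        loop-fair : ∀ ι → ∃ λ q → suc r ≤ q × q ≤ e′ + suc r × bit ι (α q) ≡ true
        loop-fair ι with accumulator-sound z (trans (cong proj₂ z₀) (sym (cong (discharged ψ ∘ proj₂ ∘ proj₁) z₀)))
                                           walk-z ι (trans (cong (λ z → Vec.lookup (proj₂ z) ι) zₑ) (loop-covers ι))
        ... | d , d≤e′ , bit-d = d + suc r , m≤n+m (suc r) d , +-monoˡ-≤ (suc r) d≤e′ ,
                                 trans (cong (bit ι) (splice-> r u ν d)) bit-d

    annotated-lasso⇒lasso : (A : AnnotatedLasso) → ∃ λ ρ → IsPath M ρ × Initialised M ρ ×
                            IsLoop M (AnnotatedLasso.k A) (AnnotatedLasso.l A) ρ × ρ ^ 0 ⊨ ψ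
    annotated-lasso⇒lasso A =
      proj₁ ∘ α ∘ idx , proj₁ ∘ step , initial , unroll-isLoop 0<l l≤k (proj₁ ∘ α) repeat ,
      fair-annotation-sound ψ (proj₂ ∘ step) (fair recurs) 0 accepting
      where
      open AnnotatedLasso A
      open LassoIndex k l l≤k
      step : ∀ t → Step (α (idx t)) (α (idx (suc t)))
      step = unroll-step Step α walk back
      recurs : ∀ ι q → ∃ λ w → q ≤ w × bit ι (α (idx w)) ≡ true
      recurs ι q with discharges ι
      ... | u , l≤u , u≤k , bit-u with idx-recurrent l≤u u≤k q
      ...   | w , q≤w , idx-w = w , q≤w , subst (λ v → bit ι (α v) ≡ true) (sym idx-w) bit-u

    -- A satisfying assignment determined by finitely many data, so that its existence is decidable.
    SmallLassoModel : Set
    SmallLassoModel = ∃ λ k → k < bound × ∃ λ (v : Vec State (suc k)) → ∃ λ l → l < suc k ×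
                      Encoding.encoding M k (loopAssignment (at v) l) ψ ≡ true

    smallLassoModel? : Dec SmallLassoModel
    smallLassoModel? =
      anyUpTo? (λ k → ∃?-finite (finite-Vec (finite-Vec finite-Bool n) (suc k)) λ v →
                 anyUpTo? (λ l → Encoding.encoding M k (loopAssignment (at v) l) ψ Bool.≟ true) (suc k))
               bound

    annotated-lasso⇒small-model : AnnotatedLasso → SmallLassoModel
    annotated-lasso⇒small-model A with annotated-lasso⇒lasso A
    ... | ρ , path , init , loop , sat =
      k , k<bound , Vec.tabulate (ρ ∘ toℕ) , l , s≤s l≤k ,
      lasso-encoded path init (λ _ u≤k → at-tabulate ρ u≤k) ψ loop sat
      where open AnnotatedLasso A

    module _ {π : Path} (path : IsPath M π) (init : Initialised M π) (sat : π ^ 0 ⊨ ψ) where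

      private
        N : ℕ
        N = size finite-Node

      Discharging : ℕ → ℕ → Set
      Discharging x y = x < y × ∀ ι → ∃ λ w → x ≤ w × w ≤ y × Obligation π (Vec.lookup (untils ψ) ι) w

      module _ (p : ℕ → ℕ) (p-steps : ∀ x → x < N → Discharging (p x) (p (suc x)))
               (A : ℕ → Ann ψ) (correct : ∀ t → t ≤ p N → Correct π ψ t (A t)) where

        private
          τ : ℕ → Node
          τ t = π t , A t

        p-mono : ∀ {x y} → x < y → y ≤ N → p x < p y
        p-mono {x} {suc y} x<1+y 1+y≤N with m<1+n⇒m<n∨m≡n x<1+y
        ... | inj₁ x<y  = <-trans (p-mono x<y (<⇒≤ 1+y≤N)) (proj₁ (p-steps y 1+y≤N))
        ... | inj₂ refl = proj₁ (p-steps x 1+y≤N)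

        p-mono≤ : ∀ {x y} → x ≤ y → y ≤ N → p x ≤ p y
        p-mono≤ x≤y y≤N with m≤n⇒m<n∨m≡n x≤y
        ... | inj₁ x<y  = <⇒≤ (p-mono x<y y≤N)
        ... | inj₂ refl = ≤-refl

        discharged-bit : ∀ {t} → t ≤ p N → ∀ ι → Obligation π (Vec.lookup (untils ψ) ι) t →
                         bit ι (τ t) ≡ true
        discharged-bit t≤pN ι = reflected⇒true (Pointwise.lookup (discharged-reflects π ψ (correct _ t≤pN)) ι)

        steps : ∀ t → t < p N → Step (τ t) (τ (suc t))
        steps t t<pN = path t , correct⇒consistent π ψ (correct t (<⇒≤ t<pN)) (correct (suc t) t<pN)

        segment : Segment
        segment with pigeonhole-ℕ finite-Node (τ ∘ p)
        ... | a , b , a<b , b≤N , τ-repeat = record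
          { τ = τ ; i = p a ; j = p b ; i<j = p-mono a<b b≤N
          ; walk = λ t t<j → steps t (<-≤-trans t<j (p-mono≤ b≤N ≤-refl))
          ; repeat = τ-repeat ; initial = init
          ; accepting = reflected⇒true (proj₁ (correct 0 z≤n)) sat
          ; discharges = covered
          }
          where
          covered : ∀ ι → ∃ λ t → p a < t × t ≤ p b × bit ι (τ t) ≡ true
          covered ι with proj₂ (p-steps a (<-≤-trans a<b b≤N)) ι
          ... | w , pa≤w , w≤pa+1 , obligation with m≤n⇒m<n∨m≡n pa≤w
          ...   | inj₁ pa<w  = w , pa<w , w≤pb , bit-w
            where
            w≤pb : w ≤ p b
            w≤pb = ≤-trans w≤pa+1 (p-mono≤ a<b b≤N)
            bit-w : bit ι (τ w) ≡ true
            bit-w = discharged-bit (≤-trans w≤pb (p-mono≤ b≤N ≤-refl)) ι obligation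
          ...   | inj₂ refl = p b , p-mono a<b b≤N , ≤-refl , trans (cong (bit ι) (sym τ-repeat)) bit-pa
            where
            bit-pa : bit ι (τ (p a)) ≡ true
            bit-pa = discharged-bit (p-mono≤ (<⇒≤ (<-≤-trans a<b b≤N)) ≤-refl) ι obligation

      -- Positions p 0 < … < p N are chosen so that every eventuality pending at p x is discharged
      -- by p (x + 1); two of them carry the same node.
      ¬¬segment : ¬ ¬ Segment
      ¬¬segment = do
        p , _ , p-steps ← ¬¬-iterate (λ x → ¬¬-bound x λ ι → eventually-discharged π (Vec.lookup (untils ψ) ι) x)
                                     N 0
        A , correct ← ¬¬-choice≤ (correct-exists π ψ) (p N)
        return (segment p p-steps A correct)
  
    completeness : ∀ {π} → IsPath M π → Initialised M π → π ^ 0 ⊨ ψ → ∃ λ k → Satisfiable M ψ k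
    completeness path init sat =
      satisfiable (decidable-stable smallLassoModel?
                    (¬¬-map (annotated-lasso⇒small-model ∘ SegmentShortening.annotated-lasso)
                            (¬¬segment path init sat)))
      where
      satisfiable : SmallLassoModel → ∃ λ k → Satisfiable M ψ k
      satisfiable (k , _ , v , l , _ , enc) = k , loopAssignment (at v) l , enc

theorem3p1 : {AP : Set} (M : Kripke AP) (ψ : LTL AP) →
    ((∃ λ π → IsPath M π × Initialised M π × (_,_⊨_ M π 0 ψ))
       ⇔ (∃ λ (k : ℕ) → Satisfiable M ψ k))
    × (∀ (k : ℕ) π → IsPath M π → Initialised M π → _⊨[_]_ M π k ψ → Satisfiable M ψ k)
theorem3p1 M ψ =
  mk⇔ (λ (π , path , init , sat) → completeness M ψ path init sat) (λ (k , sat) → soundness M ψ k sat) ,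
  bounded-completeness M ψ
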